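{- Let $N\ge1$. To $(x,y)\in(\mathbb Z/N\mathbb Z)^2$ associate the triple $[q_1,q_2,u]$ with $q_1=\gcd(x,N)$, $q_2=\gcd(y,q_1)$, $u=\frac{x}{q_1}\frac{y}{q_2}\bmod \gcd(\frac N{q_1},\frac{q_1}{q_2})$ (an element of $(\mathbb Z/\gcd(\frac N{q_1},\frac{q_1}{q_2})\mathbb Z)^*$). Let $\mathcal O_N$ be the set of triples $[q_1,q_2,u]$ with $q_2\mid q_1\mid N$ and $u\in(\mathbb Z/\gcd(\frac N{q_1},\frac{q_1}{q_2})\mathbb Z)^*$. Then: (1) this map induces a bijection between the set of orbits of $(\mathbb Z/N\mathbb Z)^2$ under the action $(x,y)\mapsto(x,y)\gamma$ of $\Gamma_0(N)$ and $\mathcal O_N$; (2) a representative of the orbit corresponding to $[q_1,q_2,u]$ is $(q_1,q_2v)$ where $v$ is a representative of $u$ in $\mathbb Z/\frac N{q_2}\mathbb Z$ prime to $\frac{q_1}{q_2}$; (3) the cardinality of the orbit corresponding to $[q_1,q_2,u]$ is $\dfrac{\frac N{q_1}\varphi(\frac N{q_1})\varphi(\frac{q_1}{q_2})}{\varphi(\gcd(\frac N{q_1},\frac{q_1}{q_2}))}$.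
   Context: $\Gamma_0(N)$ is the group of matrices in $\mathrm{SL}_2(\mathbb Z)$ with lower-left entry divisible by $N$; $\varphi$ is Euler's function; for $x\in\mathbb Z/N\mathbb Z$, $\gcd(x,N)$ is the gcd of $N$ with any lift (equal to $N$ for $x=0$). -}

module Defs where

open import Data.Nat using (ℕ; zero; suc; _+_; _*_; _<_; _≤_; _%_; _/_)
open import Data.Nat.GCD using (gcd)
open import Data.Nat.Divisibility using (_∣_)
open import Data.Nat.Properties using (_≟_)
open import Data.List using (List; length; filter; upTo; map)
open import Data.Fin using (Fin; toℕ)
open import Data.Product using (_×_; _,_; Σ; ∃; proj₁; proj₂)
open import Relation.Binary.PropositionalEquality using (_≡_)
import Data.Integer as ℤ
open import Data.Integer using (ℤ; +_)
import Data.Integer.Divisibility as ℤd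

-- Total truncated division / remainder (the divisor is always nonzero
-- where these are used in the theorem; the value at 0 is irrelevant).
_div_ : ℕ → ℕ → ℕ
m div zero    = zero
m div (suc n) = m / suc n

_mod_ : ℕ → ℕ → ℕ
m mod zero    = m
m mod (suc n) = m % suc n

φ : ℕ → ℕ
φ n = length (filter (λ k → gcd (suc k) n ≟ 1) (upTo n))

record Triple : Set where
  constructor [_,_,_]
  field
    q₁ q₂ u : ℕ
open Triple public

gT : ℕ → ℕ → ℕ → ℕ
gT N q₁ q₂ = gcd (N div q₁) (q₁ div q₂)

-- Membership in 𝒪_N : q₂ ∣ q₁ ∣ N and u ∈ (ℤ/gℤ)^*  (u taken as its
-- canonical representative in [0, g)).
InO : ℕ → Triple → Set
InO N [ q₁ , q₂ , u ] =
  q₂ ∣ q₁ × q₁ ∣ N × u < gT N q₁ q₂ × gcd u (gT N q₁ q₂) ≡ 1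

-- The map (x , y) ↦ [q₁ , q₂ , u]; (x, y) are arbitrary natural lifts of
-- elements of ℤ/Nℤ, first reduced mod N.
cls : ℕ → ℕ × ℕ → Triple
cls N (x₀ , y₀) = [ r₁ , r₂ , ((x div r₁) * (y div r₂)) mod (gT N r₁ r₂) ]
  where
  x = x₀ mod N
  y = y₀ mod N
  r₁ = gcd x N
  r₂ = gcd y r₁

Pt : ℕ → Set
Pt N = Fin N × Fin N

lift : {N : ℕ} → Pt N → ℕ × ℕ
lift (x , y) = (toℕ x , toℕ y)

record Γ₀ (N : ℕ) : Set where
  constructor mat
  field
    a b c d : ℤ
    det≡1   : a ℤ.* d ℤ.- b ℤ.* c ≡ + 1
    N∣c     : (+ N) ℤd.∣ c

_≡[mod_]_ : ℤ → ℕ → ℤ → Set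
i ≡[mod N ] j = (+ N) ℤd.∣ (i ℤ.- j)

_·_≡_ : {N : ℕ} → Pt N → Γ₀ N → Pt N → Set
_·_≡_ {N} (x , y) γ (x' , y') =
  ((X ℤ.* a ℤ.+ Y ℤ.* c) ≡[mod N ] (+ toℕ x')) ×
  ((X ℤ.* b ℤ.+ Y ℤ.* d) ≡[mod N ] (+ toℕ y'))
  where
  open Γ₀ γ
  X = + toℕ x
  Y = + toℕ y

SameOrbit : {N : ℕ} → Pt N → Pt N → Set
SameOrbit {N} p p' = Σ (Γ₀ N) λ γ → p · γ ≡ p'

module Submission where

-- Modulo N a matrix of Γ₀(N) is upper triangular (a b; 0 d) with ad ≡ 1, so it sends (x, y) to
-- (xa, xb + yd). Writing x = q₁ξ and y = q₂η, the gcds q₁ = gcd(x, N) and q₂ = gcd(y, q₁) are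
-- unchanged and ξη gets multiplied by ad ≡ 1, so ξη mod g = gcd(N/q₁, q₁/q₂) is invariant.
-- Conversely, if (x', y') has the same invariants, a ≡ ξ'ξ⁻¹ mod N/q₁ can be corrected modulo
-- q₁/q₂ so that aη' ≡ η (possible because ξη ≡ ξ'η' mod g), lifted to a unit mod N, and then d
-- and b are read off from y. Finally, multiplying x by a unit mod N permutes the points with fixed q₁, q₂ and
-- carries the fiber of each unit w mod g onto that of u; so the φ(g) fibers have equal size and
-- together contain the φ(N/q₁) · (N/q₁)φ(q₁/q₂) pairs with gcd(x, N) = q₁ and gcd(y, q₁) = q₂.

import Data.Nat as ℕ
open ℕ using (ℕ; NonZero)

module Congruence where

  open import Data.Nat using (zero; suc)
  open import Data.Integer using (ℤ; +_; -[1+_]; -_; _+_; _-_; _*_; 0ℤ; 1ℤ; ∣_∣)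
  open import Data.Integer.Properties using (pos-*; pos-+; +-injective; +-identityʳ; *-identityʳ; *-cancelˡ-≡; abs-*; *-comm; *-assoc; *-zeroʳ)
  open import Data.Integer.Tactic.RingSolver using (solve; solve-∀)
  import Data.Integer as ℤ using (NonZero)
  import Data.Integer.DivMod as ℤ
  import Data.Nat.Properties as ℕ
  import Data.Nat.Divisibility as ℕ
  import Data.Nat.DivMod as ℕ
  import Data.Nat.GCD as ℕ
  import Data.Nat.Coprimality as ℕ
  open import Algebra.Properties.CommutativeSemigroup ℕ.*-commutativeSemigroup using (x∙yz≈y∙xz)
  open import Data.Nat.Induction using (<-rec)
  open import Data.List using ([]; _∷_)
  open import Data.Product using (∃; ∃₂; _×_; _,_; proj₁; proj₂)
  open import Relation.Nullary using (yes; no)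
  open import Relation.Binary.Bundles using (Setoid)
  open import Relation.Binary.PropositionalEquality
  open import Defs using (_div_; _mod_)

  infix 4 _≋_[_]
  infixr 4 _,≋_
  record _≋_[_] (a b n : ℤ) : Set where
    constructor _,≋_
    field
      quotient : ℤ
      equality : a - b ≡ quotient * n

  ≡+quotient : ∀ {a b n} (p : a ≋ b [ n ]) → a ≡ b + _≋_[_].quotient p * n
  ≡+quotient {a} {b} {n} (t ,≋ e) = begin
    a            ≡⟨ solve (a ∷ b ∷ []) ⟩
    b + (a - b)  ≡⟨ cong (λ z → b + z) e ⟩
    b + t * n    ∎
    where open ≡-Reasoning

  module _ {n : ℤ} where

    ≋-refl : ∀ {a} → a ≋ a [ n ]
    ≋-refl {a} = 0ℤ ,≋ solve (a ∷ n ∷ [])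

    ≋-reflexive : ∀ {a b} → a ≡ b → a ≋ b [ n ]
    ≋-reflexive refl = ≋-refl

    ≋-sym : ∀ {a b} → a ≋ b [ n ] → b ≋ a [ n ]
    ≋-sym {a} {b} (t ,≋ e) = - t ,≋ (begin
      b - a     ≡⟨ solve (a ∷ b ∷ []) ⟩
      - (a - b) ≡⟨ cong -_ e ⟩
      - (t * n) ≡⟨ solve (t ∷ n ∷ []) ⟩
      - t * n   ∎)
      where open ≡-Reasoning

    ≋-trans : ∀ {a b c} → a ≋ b [ n ] → b ≋ c [ n ] → a ≋ c [ n ]
    ≋-trans {a} {b} {c} (t ,≋ e) (s ,≋ f) = t + s ,≋ (begin
      a - c             ≡⟨ solve (a ∷ b ∷ c ∷ []) ⟩
      (a - b) + (b - c) ≡⟨ cong₂ _+_ e f ⟩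
      t * n + s * n     ≡⟨ solve (t ∷ s ∷ n ∷ []) ⟩
      (t + s) * n       ∎)
      where open ≡-Reasoning

    ≋-setoid : Setoid _ _
    ≋-setoid = record
      { Carrier = ℤ
      ; _≈_ = λ a b → a ≋ b [ n ]
      ; isEquivalence = record { refl = ≋-refl ; sym = ≋-sym ; trans = ≋-trans }
      }

    +-cong : ∀ {a b c d} → a ≋ b [ n ] → c ≋ d [ n ] → a + c ≋ b + d [ n ]
    +-cong {a} {b} {c} {d} (t ,≋ e) (s ,≋ f) = t + s ,≋ (begin
      (a + c) - (b + d) ≡⟨ solve (a ∷ b ∷ c ∷ d ∷ []) ⟩
      (a - b) + (c - d) ≡⟨ cong₂ _+_ e f ⟩
      t * n + s * n     ≡⟨ solve (t ∷ s ∷ n ∷ []) ⟩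
      (t + s) * n       ∎)
      where open ≡-Reasoning

    *-cong : ∀ {a b c d} → a ≋ b [ n ] → c ≋ d [ n ] → a * c ≋ b * d [ n ]
    *-cong {a} {b} {c} {d} (t ,≋ e) (s ,≋ f) = a * s + t * d ,≋ (begin
      a * c - b * d             ≡⟨ solve (a ∷ b ∷ c ∷ d ∷ []) ⟩
      a * (c - d) + (a - b) * d ≡⟨ cong₂ (λ u v → a * u + v * d) f e ⟩
      a * (s * n) + (t * n) * d ≡⟨ solve (a ∷ s ∷ t ∷ n ∷ d ∷ []) ⟩
      (a * s + t * d) * n       ∎)
      where open ≡-Reasoning

    +-congˡ : ∀ {a b} c → a ≋ b [ n ] → c + a ≋ c + b [ n ]
    +-congˡ c = +-cong (≋-refl {c})

    +-congʳ : ∀ {a b} c → a ≋ b [ n ] → a + c ≋ b + c [ n ]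
    +-congʳ c p = +-cong p (≋-refl {c})

    *-congˡ : ∀ {a b} c → a ≋ b [ n ] → c * a ≋ c * b [ n ]
    *-congˡ c = *-cong (≋-refl {c})

    *-congʳ : ∀ {a b} c → a ≋ b [ n ] → a * c ≋ b * c [ n ]
    *-congʳ c p = *-cong p (≋-refl {c})

  module ≋-Reasoning (n : ℤ) where
    open import Relation.Binary.Reasoning.Setoid (≋-setoid {n}) public

  ≋-resp-modulus : ∀ {a b n n'} → n ≡ n' → a ≋ b [ n ] → a ≋ b [ n' ]
  ≋-resp-modulus refl p = p

  +-multiple : ∀ a k n → a + k * n ≋ a [ n ]
  +-multiple a k n = k ,≋ solve (a ∷ k ∷ n ∷ [])

  modulus≋0 : ∀ n → n ≋ 0ℤ [ n ]
  modulus≋0 n = 1ℤ ,≋ solve (n ∷ [])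

  *-scaleˡ : ∀ {a b n} c → a ≋ b [ n ] → c * a ≋ c * b [ c * n ]
  *-scaleˡ {a} {b} {n} c (t ,≋ e) = t ,≋ (begin
    c * a - c * b ≡⟨ solve (c ∷ a ∷ b ∷ []) ⟩
    c * (a - b)   ≡⟨ cong (c *_) e ⟩
    c * (t * n)   ≡⟨ solve (c ∷ t ∷ n ∷ []) ⟩
    t * (c * n)   ∎)
    where open ≡-Reasoning

  *-cancelˡ : ∀ {a b n} c .{{_ : ℤ.NonZero c}} → c * a ≋ c * b [ c * n ] → a ≋ b [ n ]
  *-cancelˡ {a} {b} {n} c (t ,≋ e) = t ,≋ *-cancelˡ-≡ c (a - b) (t * n) (begin
    c * (a - b)   ≡⟨ solve (c ∷ a ∷ b ∷ []) ⟩
    c * a - c * b ≡⟨ e ⟩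
    t * (c * n)   ≡⟨ solve (c ∷ t ∷ n ∷ []) ⟩
    c * (t * n)   ∎)
    where open ≡-Reasoning

  divide-by-unit : ∀ {u v c c̄ n} → u ≋ v * c [ n ] → c * c̄ ≋ 1ℤ [ n ] → v ≋ u * c̄ [ n ]
  divide-by-unit {u} {v} {c} {c̄} {n} u≋vc cc̄≋1 = begin
    v             ≡⟨ solve (v ∷ []) ⟩
    v * 1ℤ        ≈⟨ *-congˡ v cc̄≋1 ⟨
    v * (c * c̄)   ≡⟨ solve (v ∷ c ∷ c̄ ∷ []) ⟩
    v * c * c̄     ≈⟨ *-congʳ c̄ u≋vc ⟨
    u * c̄         ∎
    where open ≋-Reasoning n

  *-cancelʳ-unit : ∀ {a b s s̄ n} → a * s ≋ b * s [ n ] → s * s̄ ≋ 1ℤ [ n ] → a ≋ b [ n ]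
  *-cancelʳ-unit {a} {b} {s} {s̄} {n} as≋bs ss̄≋1 = begin
    a              ≡⟨ solve (a ∷ []) ⟩
    a * 1ℤ         ≈⟨ *-congˡ a ss̄≋1 ⟨
    a * (s * s̄)    ≡⟨ solve (a ∷ s ∷ s̄ ∷ []) ⟩
    a * s * s̄      ≈⟨ *-congʳ s̄ as≋bs ⟩
    b * s * s̄      ≡⟨ solve (b ∷ s ∷ s̄ ∷ []) ⟩
    b * (s * s̄)    ≈⟨ *-congˡ b ss̄≋1 ⟩
    b * 1ℤ         ≡⟨ solve (b ∷ []) ⟩
    b              ∎
    where open ≋-Reasoning n

  y≡x*0+y*1 : ∀ x y → y ≡ x * 0ℤ + y * 1ℤ
  y≡x*0+y*1 = solve-∀

  record Coprime (a b : ℤ) : Set where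
    constructor bézout
    field
      x y : ℤ
      identity : a * x + b * y ≡ 1ℤ

  coprime-sym : ∀ {a b} → Coprime a b → Coprime b a
  coprime-sym {a} {b} (bézout r s e) = bézout s r (begin
    b * s + a * r ≡⟨ solve (a ∷ b ∷ r ∷ s ∷ []) ⟩
    a * r + b * s ≡⟨ e ⟩
    1ℤ            ∎)
    where open ≡-Reasoning

  coprime-resp-≋ : ∀ {a a' n} → a' ≋ a [ n ] → Coprime a n → Coprime a' n
  coprime-resp-≋ {a} {a'} {n} (t ,≋ f) (bézout r s e) = bézout r (s - t * r) (begin
    a' * r + n * (s - t * r)                      ≡⟨ solve (a ∷ a' ∷ r ∷ n ∷ s ∷ t ∷ []) ⟩
    (a' - a) * r + (a * r + n * s) - (t * n) * r  ≡⟨ cong₂ (λ u v → u * r + v - (t * n) * r) f e ⟩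
    (t * n) * r + 1ℤ - (t * n) * r                ≡⟨ solve (t ∷ n ∷ r ∷ []) ⟩
    1ℤ                                            ∎)
    where open ≡-Reasoning

  coprime-* : ∀ {a b n} → Coprime a n → Coprime b n → Coprime (a * b) n
  coprime-* {a} {b} {n} (bézout r s e) (bézout r' s' e') =
    bézout (r * r') (a * r * s' + s * b * r' + s * n * s') (begin
      a * b * (r * r') + n * (a * r * s' + s * b * r' + s * n * s') ≡⟨ solve (a ∷ b ∷ n ∷ r ∷ s ∷ r' ∷ s' ∷ []) ⟩
      (a * r + n * s) * (b * r' + n * s')                           ≡⟨ cong₂ _*_ e e' ⟩
      1ℤ                                                            ∎)
    where open ≡-Reasoning

  coprime-*⇒coprimeˡ : ∀ {a b n} → Coprime (a * b) n → Coprime a n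
  coprime-*⇒coprimeˡ {a} {b} {n} (bézout r s e) = bézout (b * r) s (begin
    a * (b * r) + n * s ≡⟨ solve (a ∷ b ∷ r ∷ n ∷ s ∷ []) ⟩
    a * b * r + n * s   ≡⟨ e ⟩
    1ℤ                  ∎)
    where open ≡-Reasoning

  coprime-1 : ∀ n → Coprime 1ℤ n
  coprime-1 n = bézout 1ℤ 0ℤ (solve (n ∷ []))

  coprime⇒inverse : ∀ {a n} → Coprime a n → ∃ λ r → a * r ≋ 1ℤ [ n ]
  coprime⇒inverse {a} {n} (bézout r s e) = r , (- s ,≋ (begin
    a * r - 1ℤ               ≡⟨ cong (λ z → a * r - z) (sym e) ⟩
    a * r - (a * r + n * s)  ≡⟨ solve (a ∷ r ∷ n ∷ s ∷ []) ⟩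
    - s * n                  ∎))
    where open ≡-Reasoning

  inverse⇒coprime : ∀ {a r n} → a * r ≋ 1ℤ [ n ] → Coprime a n
  inverse⇒coprime {a} {r} {n} (t ,≋ e) = bézout r (- t) (begin
    a * r + n * - t            ≡⟨ solve (a ∷ r ∷ n ∷ t ∷ []) ⟩
    (a * r - 1ℤ) - t * n + 1ℤ  ≡⟨ cong (λ z → z - t * n + 1ℤ) e ⟩
    t * n - t * n + 1ℤ         ≡⟨ solve (t ∷ n ∷ []) ⟩
    1ℤ                         ∎)
    where open ≡-Reasoning

  coprime-*ʳ : ∀ {x a b} → Coprime x a → Coprime x b → Coprime x (a * b)
  coprime-*ʳ x⊥a x⊥b = coprime-sym (coprime-* (coprime-sym x⊥a) (coprime-sym x⊥b))

  ∣⇒≋0 : ∀ {k n} → k ℕ.∣ n → + n ≋ 0ℤ [ + k ]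
  ∣⇒≋0 {k} {n} (ℕ.divides q e) = + q ,≋ trans (+-identityʳ (+ n)) (trans (cong +_ e) (pos-* q k))

  ≋0⇒∣ : ∀ {k n} → + n ≋ 0ℤ [ + k ] → k ℕ.∣ n
  ≋0⇒∣ {k} {n} (t ,≋ e) = ℕ.divides ∣ t ∣ (begin
    ∣ + n ∣        ≡⟨ cong ∣_∣ (sym (+-identityʳ (+ n))) ⟩
    ∣ + n - 0ℤ ∣   ≡⟨ cong ∣_∣ e ⟩
    ∣ t * + k ∣    ≡⟨ abs-* t (+ k) ⟩
    ∣ t ∣ ℕ.* k    ∎)
    where open ≡-Reasoning

  ≋-divisor : ∀ {a b k n} → k ℕ.∣ n → a ≋ b [ + n ] → a ≋ b [ + k ]
  ≋-divisor {a} {b} {k} (ℕ.divides q refl) (t ,≋ e) = t * + q ,≋ (begin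
    a - b                ≡⟨ e ⟩
    t * + (q ℕ.* k)      ≡⟨ cong (t *_) (pos-* q k) ⟩
    t * (+ q * + k)      ≡⟨ sym (*-assoc t (+ q) (+ k)) ⟩
    t * + q * + k        ∎)
    where open ≡-Reasoning

  coprime-divisor : ∀ {a k n} → k ℕ.∣ n → Coprime a (+ n) → Coprime a (+ k)
  coprime-divisor {a} {k} (ℕ.divides q refl) (bézout r s e) = bézout r (+ q * s) (begin
    a * r + + k * (+ q * s)  ≡⟨ cong (λ z → a * r + z) (reassoc (+ k) (+ q) s) ⟩
    a * r + + q * + k * s    ≡⟨ cong (λ z → a * r + z * s) (sym (pos-* q k)) ⟩
    a * r + + (q ℕ.* k) * s  ≡⟨ e ⟩
    1ℤ                       ∎)
    where
    open ≡-Reasoning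
    reassoc : ∀ k q s → k * (q * s) ≡ q * k * s
    reassoc = solve-∀

  coprime-^ : ∀ {x} A k → Coprime x (+ A) → Coprime x (+ (A ℕ.^ k))
  coprime-^ {x} A zero    _   = coprime-sym (coprime-1 x)
  coprime-^ {x} A (suc k) x⊥A =
    subst (Coprime x) (sym (pos-* A (A ℕ.^ k))) (coprime-*ʳ x⊥A (coprime-^ A k x⊥A))

  n≡[n/d]*d : ∀ {d n} → d ℕ.∣ n → n ≡ d ℕ.* (n div d)
  n≡[n/d]*d {zero}  (ℕ.divides q e) = trans e (ℕ.*-zeroʳ q)
  n≡[n/d]*d {suc d} d∣n             = sym (ℕ.m*[n/m]≡n d∣n)

  div≡/ : ∀ m d .{{_ : NonZero d}} → m div d ≡ m ℕ./ d
  div≡/ m (suc d) = refl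

  gcd-of-divisor : ∀ {m n} → m ℕ.∣ n → ℕ.gcd m n ≡ m
  gcd-of-divisor {m} {n} m∣n = ℕ.∣-antisym (ℕ.gcd[m,n]∣m m n) (ℕ.gcd-greatest ℕ.∣-refl m∣n)

  cofactors-coprime : ∀ m n → n ≢ 0 → ℕ.gcd (m div ℕ.gcd m n) (n div ℕ.gcd m n) ≡ 1
  cofactors-coprime m n n≢0 = ℕ.coprime⇒gcd≡1
    (subst₂ ℕ.Coprime (sym (div≡/ m (ℕ.gcd m n))) (sym (div≡/ n (ℕ.gcd m n))) (ℕ.coprime-/gcd m n))
    where
    instance
      _ : NonZero (ℕ.gcd m n)
      _ = ℕ.≢-nonZero (λ gcd≡0 → n≢0 (ℕ.gcd[m,n]≡0⇒n≡0 m gcd≡0))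

  coprime⇒gcd≡1 : ∀ {a b} → Coprime (+ a) (+ b) → ℕ.gcd a b ≡ 1
  coprime⇒gcd≡1 {a} {b} (bézout r s e) = ℕ.∣1⇒≡1 (≋0⇒∣ (subst (λ z → z ≋ 0ℤ [ + g ]) e (begin
    + a * r + + b * s  ≈⟨ +-cong (*-congʳ r (∣⇒≋0 (ℕ.gcd[m,n]∣m a b))) (*-congʳ s (∣⇒≋0 (ℕ.gcd[m,n]∣n a b))) ⟩
    0ℤ * r + 0ℤ * s    ≡⟨ solve (r ∷ s ∷ []) ⟩
    0ℤ                 ∎)))
    where
    g = ℕ.gcd a b
    open ≋-Reasoning (+ g)

  difference≡1 : ∀ {p q} → 1 ℕ.+ q ≡ p → + p - + q ≡ 1ℤ
  difference≡1 {q = q} refl = begin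
    + (1 ℕ.+ q) - + q ≡⟨ cong (_- + q) (pos-+ 1 q) ⟩
    1ℤ + + q - + q    ≡⟨ cancel (+ q) ⟩
    1ℤ                ∎
    where
    open ≡-Reasoning
    cancel : ∀ z → 1ℤ + z - z ≡ 1ℤ
    cancel = solve-∀

  gcd≡1⇒coprime : ∀ {a b} → ℕ.gcd a b ≡ 1 → Coprime (+ a) (+ b)
  gcd≡1⇒coprime {a} {b} e with ℕ.Bézout.identity (subst (ℕ.GCD a b) e (ℕ.gcd-GCD a b))
  ... | ℕ.Bézout.+- x y eq = bézout (+ x) (- + y) (begin
    + a * + x + + b * - + y  ≡⟨ reorder (+ a) (+ x) (+ b) (+ y) ⟩
    + x * + a - + y * + b    ≡⟨ cong₂ _-_ (sym (pos-* x a)) (sym (pos-* y b)) ⟩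
    + (x ℕ.* a) - + (y ℕ.* b) ≡⟨ difference≡1 eq ⟩
    1ℤ                       ∎)
    where
    open ≡-Reasoning
    reorder : ∀ a x b y → a * x + b * - y ≡ x * a - y * b
    reorder = solve-∀
  ... | ℕ.Bézout.-+ x y eq = bézout (- + x) (+ y) (begin
    + a * - + x + + b * + y  ≡⟨ reorder (+ a) (+ x) (+ b) (+ y) ⟩
    + y * + b - + x * + a    ≡⟨ cong₂ _-_ (sym (pos-* y b)) (sym (pos-* x a)) ⟩
    + (y ℕ.* b) - + (x ℕ.* a) ≡⟨ difference≡1 eq ⟩
    1ℤ                       ∎)
    where
    open ≡-Reasoning
    reorder : ∀ a x b y → a * - x + b * y ≡ y * b - x * a
    reorder = solve-∀

  mod≋ : ∀ n d → + (n mod d) ≋ + n [ + d ]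
  mod≋ n zero    = ≋-refl
  mod≋ n (suc d) = - + q ,≋ (begin
    + r - + n                      ≡⟨ cong (λ z → + r - + z) (ℕ.m≡m%n+[m/n]*n n (suc d)) ⟩
    + r - + (r ℕ.+ q ℕ.* suc d)    ≡⟨ cong (λ z → + r - z) (trans (pos-+ r _) (cong (λ z → + r + z) (pos-* q (suc d)))) ⟩
    + r - (+ r + + q * + suc d)    ≡⟨ cancel (+ r) (+ q) (+ suc d) ⟩
    - + q * + suc d                ∎)
    where
    open ≡-Reasoning
    r = n ℕ.% suc d
    q = n ℕ./ suc d
    cancel : ∀ r q d → r - (r + q * d) ≡ - q * d
    cancel = solve-∀

  nonneg-quotient⇒mod≡ : ∀ {a b k} d → + a ≡ + b + + k * + suc d → a ℕ.% suc d ≡ b ℕ.% suc d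
  nonneg-quotient⇒mod≡ {a} {b} {k} d e = begin
    a ℕ.% suc d                    ≡⟨ cong (ℕ._% suc d) (+-injective (trans e (sym +[b+kd]≡))) ⟩
    (b ℕ.+ k ℕ.* suc d) ℕ.% suc d  ≡⟨ ℕ.[m+kn]%n≡m%n b k (suc d) ⟩
    b ℕ.% suc d                    ∎
    where
    open ≡-Reasoning
    +[b+kd]≡ : + (b ℕ.+ k ℕ.* suc d) ≡ + b + + k * + suc d
    +[b+kd]≡ = trans (pos-+ b (k ℕ.* suc d)) (cong (λ z → + b + z) (pos-* k (suc d)))

  ≋⇒mod≡ : ∀ {a b} d → + a ≋ + b [ + d ] → a mod d ≡ b mod d
  ≋⇒mod≡ {a} {b} zero p = +-injective (trans (≡+quotient p) (trans (cong (λ z → + b + z) (*-zeroʳ (_≋_[_].quotient p))) (+-identityʳ (+ b))))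
  ≋⇒mod≡ {a} {b} (suc d) p@(+ k ,≋ _) = nonneg-quotient⇒mod≡ {a} {b} {k} d (≡+quotient p)
  ≋⇒mod≡ {a} {b} (suc d) p@(-[1+ k ] ,≋ _) = sym (nonneg-quotient⇒mod≡ {b} {a} {suc k} d (≡+quotient (≋-sym p)))

  mod≡⇒≋ : ∀ {a b} d → a mod d ≡ b mod d → + a ≋ + b [ + d ]
  mod≡⇒≋ {a} {b} d e = begin
    + a         ≈⟨ mod≋ a d ⟨
    + (a mod d) ≡⟨ cong +_ e ⟩
    + (b mod d) ≈⟨ mod≋ b d ⟩
    + b         ∎
    where open ≋-Reasoning (+ d)

  mod<divisor : ∀ n {d} → 0 ℕ.< d → n mod d ℕ.< d
  mod<divisor n {suc d} _ = ℕ.m%n<n n (suc d)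

  mod-small : ∀ {n d} → n ℕ.< d → n mod d ≡ n
  mod-small {d = suc d} = ℕ.m<n⇒m%n≡m

  ≋-residue : ∀ a M .{{_ : NonZero M}} → a ≋ + (a ℤ.%ℕ M) [ + M ]
  ≋-residue a M = ≋-trans (≋-reflexive (ℤ.a≡a%ℕn+[a/ℕn]*n a M)) (+-multiple (+ (a ℤ.%ℕ M)) (a ℤ./ℕ M) (+ M))

  mod-inverse : ∀ {s s̃ x} n → + s * + s̃ ≋ 1ℤ [ + n ] → x ℕ.< n → ((x ℕ.* s) mod n ℕ.* s̃) mod n ≡ x
  mod-inverse {s} {s̃} {x} n ss̃≋1 x<n = trans (≋⇒mod≡ n (begin
    + ((x ℕ.* s) mod n ℕ.* s̃)   ≡⟨ pos-* ((x ℕ.* s) mod n) s̃ ⟩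
    + ((x ℕ.* s) mod n) * + s̃   ≈⟨ *-congʳ (+ s̃) (mod≋ (x ℕ.* s) n) ⟩
    + (x ℕ.* s) * + s̃           ≡⟨ cong (_* + s̃) (pos-* x s) ⟩
    + x * + s * + s̃             ≡⟨ *-assoc (+ x) (+ s) (+ s̃) ⟩
    + x * (+ s * + s̃)           ≈⟨ *-congˡ (+ x) ss̃≋1 ⟩
    + x * 1ℤ                    ≡⟨ *-identityʳ (+ x) ⟩
    + x                         ∎)) (mod-small x<n)
    where open ≋-Reasoning (+ n)

  gcd∣gcd-of-multiple : ∀ {x x' n} a → + x ≋ + x' * a [ + n ] → ℕ.gcd x' n ℕ.∣ ℕ.gcd x n
  gcd∣gcd-of-multiple {x} {x'} {n} a x≋x'a = ℕ.gcd-greatest (≋0⇒∣ (begin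
    + x       ≈⟨ ≋-divisor (ℕ.gcd[m,n]∣n x' n) x≋x'a ⟩
    + x' * a  ≈⟨ *-congʳ a (∣⇒≋0 (ℕ.gcd[m,n]∣m x' n)) ⟩
    0ℤ * a    ≡⟨ solve (a ∷ []) ⟩
    0ℤ        ∎)) (ℕ.gcd[m,n]∣n x' n)
    where open ≋-Reasoning (+ ℕ.gcd x' n)

  gcd-resp-unit : ∀ {x x' n a ā} → + x' ≋ + x * a [ + n ] → a * ā ≋ 1ℤ [ + n ] → ℕ.gcd x' n ≡ ℕ.gcd x n
  gcd-resp-unit {x} {x'} {a = a} {ā} x'≋xa aā≋1 = ℕ.∣-antisym
    (gcd∣gcd-of-multiple {x} {x'} ā (divide-by-unit x'≋xa aā≋1))
    (gcd∣gcd-of-multiple {x'} {x} a x'≋xa)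

  gcd-mod : ∀ x {n M} → n ℕ.∣ M → ℕ.gcd (x mod M) n ≡ ℕ.gcd x n
  gcd-mod x {n} {M} n∣M = gcd-resp-unit {x} {x mod M} {n} {1ℤ} {1ℤ}
    (≋-trans (≋-divisor n∣M (mod≋ x M)) (≋-reflexive (sym (*-identityʳ (+ x))))) ≋-refl

  -- Strip the common factor gcd n A from n and recurse.
  ∣coprime*power : ∀ A n → 0 ℕ.< n → ∃₂ λ c k → ℕ.gcd c A ≡ 1 × n ℕ.∣ c ℕ.* A ℕ.^ k
  ∣coprime*power A = <-rec _ step
    where
    step : ∀ n → (∀ {n'} → n' ℕ.< n → 0 ℕ.< n' → ∃₂ λ c k → ℕ.gcd c A ≡ 1 × n' ℕ.∣ c ℕ.* A ℕ.^ k) →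
           0 ℕ.< n → ∃₂ λ c k → ℕ.gcd c A ≡ 1 × n ℕ.∣ c ℕ.* A ℕ.^ k
    step n rec 0<n with ℕ.gcd n A ℕ.≟ 1
    ... | yes h≡1 = n , 0 , h≡1 , ℕ.m∣m*n 1
    ... | no h≢1 = extend (rec n'<n 0<n')
      where
      h  = ℕ.gcd n A
      n' = n div h
      n≡hn' : n ≡ h ℕ.* n'
      n≡hn' = n≡[n/d]*d (ℕ.gcd[m,n]∣m n A)
      1<h : 1 ℕ.< h
      1<h = ℕ.≤∧≢⇒< (ℕ.n≢0⇒n>0 (λ h≡0 → ℕ.<-irrefl (sym (ℕ.gcd[m,n]≡0⇒m≡0 h≡0)) 0<n)) (λ 1≡h → h≢1 (sym 1≡h))
      0<n' : 0 ℕ.< n'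
      0<n' = ℕ.n≢0⇒n>0 λ n'≡0 → ℕ.<-irrefl (sym (trans n≡hn' (trans (cong (h ℕ.*_) n'≡0) (ℕ.*-zeroʳ h)))) 0<n
      n'<n : n' ℕ.< n
      n'<n = subst (n' ℕ.<_) (trans (ℕ.*-comm n' h) (sym n≡hn')) (ℕ.m<m*n n' h {{ℕ.>-nonZero 0<n'}} 1<h)
      extend : (∃₂ λ c k → ℕ.gcd c A ≡ 1 × n' ℕ.∣ c ℕ.* A ℕ.^ k) → ∃₂ λ c k → ℕ.gcd c A ≡ 1 × n ℕ.∣ c ℕ.* A ℕ.^ k
      extend (c , k , c⊥A , n'∣cAᵏ) = c , suc k , c⊥A ,
        subst₂ ℕ._∣_ (sym n≡hn') (x∙yz≈y∙xz A c (A ℕ.^ k)) (ℕ.*-pres-∣ (ℕ.gcd[m,n]∣n n A) n'∣cAᵏ)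

  -- The lift is A + M c with A the residue of a and c from ∣coprime*power A N:
  -- it is coprime to c (being ≡ A mod c) and to A (being ≡ M c mod A), hence to N.
  lift-unit : ∀ M N {a} .{{_ : ℕ.NonZero N}} → M ℕ.∣ N → Coprime a (+ M) →
              ∃ λ s → + s ≋ a [ + M ] × Coprime (+ s) (+ N)
  lift-unit M N {a} M∣N a⊥M = s , s≋a , s⊥N
    where
    M≢0 : M ≢ 0
    M≢0 M≡0 = ℕ.≢-nonZero⁻¹ N (ℕ.0∣⇒≡0 (subst (ℕ._∣ N) M≡0 M∣N))
    instance
      _ : ℕ.NonZero M
      _ = ℕ.≢-nonZero M≢0
    A = a ℤ.%ℕ M
    a≋A : a ≋ + A [ + M ]
    a≋A = ≋-residue a M
    A⊥M : Coprime (+ A) (+ M)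
    A⊥M = coprime-resp-≋ (≋-sym a≋A) a⊥M
    c,k = ∣coprime*power A N (ℕ.>-nonZero⁻¹ N)
    c = proj₁ c,k
    k = proj₁ (proj₂ c,k)
    c⊥A : Coprime (+ c) (+ A)
    c⊥A = gcd≡1⇒coprime (proj₁ (proj₂ (proj₂ c,k)))
    s = A ℕ.+ M ℕ.* c
    s≡ : + s ≡ + A + + M * + c
    s≡ = trans (pos-+ A (M ℕ.* c)) (cong (λ z → + A + z) (pos-* M c))
    s≋a : + s ≋ a [ + M ]
    s≋a = ≋-trans (≋-reflexive (trans s≡ (cong (λ z → + A + z) (*-comm (+ M) (+ c))))) (≋-trans (+-multiple (+ A) (+ c) (+ M)) (≋-sym a≋A))
    s⊥c : Coprime (+ s) (+ c)
    s⊥c = coprime-resp-≋ (≋-trans (≋-reflexive s≡) (+-multiple (+ A) (+ M) (+ c))) (coprime-sym c⊥A)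
    s⊥A : Coprime (+ s) (+ A)
    s⊥A = coprime-resp-≋ s≋Mc (coprime-* (coprime-sym A⊥M) c⊥A)
      where
      swap : ∀ x y → x + y ≡ y + 1ℤ * x
      swap = solve-∀
      s≋Mc : + s ≋ + M * + c [ + A ]
      s≋Mc = ≋-trans (≋-reflexive (trans s≡ (swap (+ A) (+ M * + c)))) (+-multiple (+ M * + c) 1ℤ (+ A))
    s⊥N : Coprime (+ s) (+ N)
    s⊥N = coprime-divisor (proj₂ (proj₂ (proj₂ c,k)))
      (subst (Coprime (+ s)) (sym (pos-* c (A ℕ.^ k))) (coprime-*ʳ s⊥c (coprime-^ A k s⊥A)))

  -- Writing n = g n', m = g m' with g = gcd n m, the solution is a₀ + k z n,
  -- where e - a₀ c = k g and z inverts n' c modulo m'.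
  lift-solution : ∀ {n m a₀ c e} → m ≢ 0 → Coprime c (+ m) → e ≋ a₀ * c [ + ℕ.gcd n m ] →
                  ∃ λ a → a ≋ a₀ [ + n ] × a * c ≋ e [ + m ]
  lift-solution {n} {m} {a₀} {c} {e} m≢0 c⊥m (k ,≋ e-a₀c≡kg) = a₀ + k * z * + n , +-multiple a₀ (k * z) (+ n) , ac≋e
    where
    g  = ℕ.gcd n m
    n' = n div g
    m' = m div g
    n≡gn' : + n ≡ + g * + n'
    n≡gn' = trans (cong +_ (n≡[n/d]*d (ℕ.gcd[m,n]∣m n m))) (pos-* g n')
    m≡gm' : m ≡ g ℕ.* m'
    m≡gm' = n≡[n/d]*d (ℕ.gcd[m,n]∣n n m)
    n'c⊥m' : Coprime (+ n' * c) (+ m')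
    n'c⊥m' = coprime-* (gcd≡1⇒coprime {n'} {m'} (cofactors-coprime n m m≢0)) (coprime-divisor (ℕ.divides g m≡gm') c⊥m)
    z = proj₁ (coprime⇒inverse n'c⊥m')
    gn'cz≋g : + g * (+ n' * c * z) ≋ + g * 1ℤ [ + m ]
    gn'cz≋g = ≋-resp-modulus (trans (sym (pos-* g m')) (cong +_ (sym m≡gm'))) (*-scaleˡ (+ g) (proj₂ (coprime⇒inverse n'c⊥m')))
    ac≋e : (a₀ + k * z * + n) * c ≋ e [ + m ]
    ac≋e = begin
      (a₀ + k * z * + n) * c                   ≡⟨ cong (λ t → (a₀ + k * z * t) * c) n≡gn' ⟩
      (a₀ + k * z * (+ g * + n')) * c          ≡⟨ expand a₀ k z (+ g) (+ n') c ⟩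
      a₀ * c + k * (+ g * (+ n' * c * z))      ≈⟨ +-congˡ (a₀ * c) (*-congˡ k gn'cz≋g) ⟩
      a₀ * c + k * (+ g * 1ℤ)                  ≡⟨ cong (λ t → a₀ * c + t) (trans (swap k (+ g)) (sym e-a₀c≡kg)) ⟩
      a₀ * c + (e - a₀ * c)                    ≡⟨ solve (a₀ ∷ c ∷ e ∷ []) ⟩
      e                                        ∎
      where
      open ≋-Reasoning (+ m)
      expand : ∀ a₀ k z g n' c → (a₀ + k * z * (g * n')) * c ≡ a₀ * c + k * (g * (n' * c * z))
      expand = solve-∀
      swap : ∀ k g → k * (g * 1ℤ) ≡ k * g
      swap = solve-∀

module Sums where

  open Congruence using (gcd-of-divisor)
  open import Data.Nat
  open import Data.Nat.Properties
  open import Algebra.Properties.CommutativeSemigroup +-commutativeSemigroup using () renaming (interchange to +-interchange)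
  open import Data.Fin using (Fin; toℕ; fromℕ<)
  import Data.Fin as Fin
  open import Data.Fin.Properties using (toℕ-fromℕ<; toℕ<n; toℕ-injective)
  open import Data.Fin.Permutation using (Permutation′; permutation; _⟨$⟩ʳ_)
  open import Algebra.Properties.CommutativeMonoid.Sum +-0-commutativeMonoid using (sum; sum-permute)
  open import Data.List using (List; []; _∷_; _++_; map; filter; length; tabulate; applyUpTo; cartesianProduct)
  open import Data.Product using (_×_; _,_)
  open import Relation.Unary using (Decidable)
  open import Relation.Nullary using (Dec; yes; no; ¬_)
  open import Data.Empty using (⊥-elim)
  open import Function using (_∘_)
  open import Relation.Binary.PropositionalEquality
  open import Data.Nat.GCD using (gcd; gcd-identityˡ; gcd[m,n]∣m; gcd[m,n]∣n; gcd-greatest; c*gcd[m,n]≡gcd[cm,cn])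
  open import Data.Nat.Divisibility using (_∣_; ∣-refl; ∣-antisym; ∣m+n∣m⇒∣n; ∣m∣n⇒∣m+n; ∣n⇒∣m*n; n∣m*n; ∣⇒≤)
  open import Defs using (φ)

  ∑< : ℕ → (ℕ → ℕ) → ℕ
  ∑< zero    f = 0
  ∑< (suc n) f = f 0 + ∑< n (f ∘ suc)

  𝟙 : ∀ {P : Set} → Dec P → ℕ
  𝟙 (yes _) = 1
  𝟙 (no _)  = 0

  𝟙-cong : ∀ {P Q : Set} (p : Dec P) (q : Dec Q) → (P → Q) → (Q → P) → 𝟙 p ≡ 𝟙 q
  𝟙-cong (yes _) (yes _) _ _ = refl
  𝟙-cong (no _)  (no _)  _ _ = refl
  𝟙-cong (yes p) (no ¬q) f _ = ⊥-elim (¬q (f p))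
  𝟙-cong (no ¬p) (yes q) _ g = ⊥-elim (¬p (g q))

  𝟙≡0 : ∀ {P : Set} (p : Dec P) → ¬ P → 𝟙 p ≡ 0
  𝟙≡0 (yes p) ¬p = ⊥-elim (¬p p)
  𝟙≡0 (no _)  _  = refl

  𝟙≡1 : ∀ {P : Set} (p : Dec P) → P → 𝟙 p ≡ 1
  𝟙≡1 (yes _) _ = refl
  𝟙≡1 (no ¬p) p = ⊥-elim (¬p p)

  *𝟙≡𝟙 : ∀ {P : Set} k (p : Dec P) → (P → k ≡ 1) → k * 𝟙 p ≡ 𝟙 p
  *𝟙≡𝟙 k (yes p) k≡1 = trans (*-identityʳ k) (k≡1 p)
  *𝟙≡𝟙 k (no _)  _   = *-zeroʳ k

  ∑<-cong : ∀ n {f g} → (∀ i → i < n → f i ≡ g i) → ∑< n f ≡ ∑< n g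
  ∑<-cong zero    _   = refl
  ∑<-cong (suc n) f≡g = cong₂ _+_ (f≡g 0 z<s) (∑<-cong n (λ i i<n → f≡g (suc i) (s<s i<n)))

  ∑<-distrib-+ : ∀ n f g → ∑< n (λ i → f i + g i) ≡ ∑< n f + ∑< n g
  ∑<-distrib-+ zero    f g = refl
  ∑<-distrib-+ (suc n) f g = trans (cong (f 0 + g 0 +_) (∑<-distrib-+ n (f ∘ suc) (g ∘ suc)))
    (+-interchange (f 0) (g 0) (∑< n (f ∘ suc)) (∑< n (g ∘ suc)))

  ∑<-*ˡ : ∀ n c f → ∑< n (λ i → c * f i) ≡ c * ∑< n f
  ∑<-*ˡ zero    c f = sym (*-zeroʳ c)
  ∑<-*ˡ (suc n) c f = trans (cong (c * f 0 +_) (∑<-*ˡ n c (f ∘ suc))) (sym (*-distribˡ-+ c (f 0) _))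

  ∑<-*ʳ : ∀ n c f → ∑< n (λ i → f i * c) ≡ ∑< n f * c
  ∑<-*ʳ n c f = trans (∑<-cong n (λ i _ → *-comm (f i) c)) (trans (∑<-*ˡ n c f) (*-comm c (∑< n f)))

  ∑<-const : ∀ n c → ∑< n (λ _ → c) ≡ n * c
  ∑<-const zero    c = refl
  ∑<-const (suc n) c = cong (c +_) (∑<-const n c)

  ∑<-zero : ∀ n f → (∀ i → i < n → f i ≡ 0) → ∑< n f ≡ 0
  ∑<-zero n f f≡0 = trans (∑<-cong n f≡0) (trans (∑<-const n 0) (*-zeroʳ n))

  ∑<-comm : ∀ a b (f : ℕ → ℕ → ℕ) → ∑< a (λ i → ∑< b (f i)) ≡ ∑< b (λ j → ∑< a (λ i → f i j))
  ∑<-comm zero    b f = sym (∑<-zero b _ (λ _ _ → refl))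
  ∑<-comm (suc a) b f = trans (cong (∑< b (f 0) +_) (∑<-comm a b (f ∘ suc)))
    (sym (∑<-distrib-+ b (f 0) (λ j → ∑< a (λ i → f (suc i) j))))

  ∑<-split : ∀ m n f → ∑< (m + n) f ≡ ∑< m f + ∑< n (λ j → f (m + j))
  ∑<-split zero    n f = refl
  ∑<-split (suc m) n f = trans (cong (f 0 +_) (∑<-split m n (f ∘ suc))) (sym (+-assoc (f 0) _ _))

  ∑<-* : ∀ a b f → ∑< (a * b) f ≡ ∑< a (λ i → ∑< b (λ j → f (i * b + j)))
  ∑<-* zero    b f = refl
  ∑<-* (suc a) b f = trans (∑<-split b (a * b) f) (cong (∑< b f +_)
    (trans (∑<-* a b (λ j → f (b + j))) (∑<-cong a (λ i _ → ∑<-cong b (λ j _ → cong f (sym (+-assoc b (i * b) j)))))))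

  ∑<-suc : ∀ n f → ∑< (suc n) f ≡ ∑< n f + f n
  ∑<-suc zero    f = +-comm (f 0) 0
  ∑<-suc (suc n) f = trans (cong (f 0 +_) (∑<-suc n (f ∘ suc))) (sym (+-assoc (f 0) _ _))

  ∑<-𝟙≡ : ∀ n k → k < n → ∑< n (λ i → 𝟙 (i ≟ k)) ≡ 1
  ∑<-𝟙≡ (suc n) zero    _ = cong suc (∑<-zero n _ (λ i _ → 𝟙-cong (suc i ≟ 0) (0 ≟ 1) (λ ()) (λ ())))
  ∑<-𝟙≡ (suc n) (suc k) (s<s k<n) = trans
    (cong₂ _+_ (𝟙-cong (0 ≟ suc k) (0 ≟ 1) (λ ()) (λ ())) (∑<-cong n (λ i _ → 𝟙-cong (suc i ≟ suc k) (i ≟ k) suc-injective (cong suc))))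
    (∑<-𝟙≡ n k k<n)

  ∑<≡sum : ∀ n f → ∑< n f ≡ sum {n} (f ∘ toℕ)
  ∑<≡sum zero    f = refl
  ∑<≡sum (suc n) f = cong (f 0 +_) (∑<≡sum n (f ∘ suc))

  ∑<-permute : ∀ n (σ τ : ℕ → ℕ) → (∀ i → i < n → σ i < n) → (∀ i → i < n → τ i < n) →
               (∀ i → i < n → τ (σ i) ≡ i) → (∀ i → i < n → σ (τ i) ≡ i) → ∀ f → ∑< n (f ∘ σ) ≡ ∑< n f
  ∑<-permute n σ τ σ< τ< τσ≡id στ≡id f = begin
    ∑< n (f ∘ σ)                       ≡⟨ ∑<≡sum n (f ∘ σ) ⟩
    sum {n} (f ∘ σ ∘ toℕ)               ≡⟨ sum-cong (λ i → cong f (sym (toℕ-fromℕ< (σ< (toℕ i) (toℕ<n i))))) ⟩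
    sum {n} (λ i → f (toℕ (π ⟨$⟩ʳ i)))  ≡⟨ sum-permute (f ∘ toℕ) π ⟨
    sum {n} (f ∘ toℕ)                   ≡⟨ ∑<≡sum n f ⟨
    ∑< n f                             ∎
    where
    open ≡-Reasoning
    π : Permutation′ n
    π = permutation (λ i → fromℕ< (σ< (toℕ i) (toℕ<n i))) (λ i → fromℕ< (τ< (toℕ i) (toℕ<n i)))
      (λ i → toℕ-injective (trans (toℕ-fromℕ< _) (trans (cong σ (toℕ-fromℕ< _)) (στ≡id (toℕ i) (toℕ<n i)))))
      (λ i → toℕ-injective (trans (toℕ-fromℕ< _) (trans (cong τ (toℕ-fromℕ< _)) (τσ≡id (toℕ i) (toℕ<n i)))))
    sum-cong : ∀ {m} {g h : Fin m → ℕ} → (∀ i → g i ≡ h i) → sum g ≡ sum h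
    sum-cong {zero}  _   = refl
    sum-cong {suc m} g≡h = cong₂ _+_ (g≡h Fin.zero) (sum-cong (g≡h ∘ Fin.suc))

  module _ {A : Set} {P : A → Set} (P? : Decidable P) where

    count : List A → ℕ
    count xs = length (filter P? xs)

    count-∷ : ∀ x xs → count (x ∷ xs) ≡ 𝟙 (P? x) + count xs
    count-∷ x xs with P? x
    ... | yes _ = refl
    ... | no _  = refl

    count-++ : ∀ xs ys → count (xs ++ ys) ≡ count xs + count ys
    count-++ []       ys = refl
    count-++ (x ∷ xs) ys = begin
      count (x ∷ xs ++ ys)                ≡⟨ count-∷ x (xs ++ ys) ⟩
      𝟙 (P? x) + count (xs ++ ys)         ≡⟨ cong (𝟙 (P? x) +_) (count-++ xs ys) ⟩
      𝟙 (P? x) + (count xs + count ys)    ≡⟨ +-assoc (𝟙 (P? x)) _ _ ⟨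
      𝟙 (P? x) + count xs + count ys      ≡⟨ cong (_+ count ys) (count-∷ x xs) ⟨
      count (x ∷ xs) + count ys           ∎
      where open ≡-Reasoning

    count-tabulate : ∀ n (f : Fin n → A) (h : ℕ → ℕ) → (∀ i → 𝟙 (P? (f i)) ≡ h (toℕ i)) → count (tabulate f) ≡ ∑< n h
    count-tabulate zero    f h _ = refl
    count-tabulate (suc n) f h f≡h = trans (count-∷ (f Fin.zero) (tabulate (f ∘ Fin.suc)))
      (cong₂ _+_ (f≡h Fin.zero) (count-tabulate n (f ∘ Fin.suc) (h ∘ suc) (f≡h ∘ Fin.suc)))

    count-applyUpTo : ∀ n (f : ℕ → A) → count (applyUpTo f n) ≡ ∑< n (λ k → 𝟙 (P? (f k)))
    count-applyUpTo zero    f = refl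
    count-applyUpTo (suc n) f = trans (count-∷ (f 0) (applyUpTo (f ∘ suc) n)) (cong (𝟙 (P? (f 0)) +_) (count-applyUpTo n (f ∘ suc)))

  module _ {A B : Set} {P : A × B → Set} (P? : Decidable P) where

    count-map-, : ∀ a ys → count P? (map (a ,_) ys) ≡ count (λ y → P? (a , y)) ys
    count-map-, a []       = refl
    count-map-, a (y ∷ ys) = trans (count-∷ P? (a , y) (map (a ,_) ys))
      (trans (cong (𝟙 (P? (a , y)) +_) (count-map-, a ys)) (sym (count-∷ (λ y → P? (a , y)) y ys)))

    count-cartesianProduct : ∀ n (f : Fin n → A) ys (h : ℕ → ℕ) →
      (∀ i → count (λ y → P? (f i , y)) ys ≡ h (toℕ i)) → count P? (cartesianProduct (tabulate f) ys) ≡ ∑< n h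
    count-cartesianProduct zero    f ys h _   = refl
    count-cartesianProduct (suc n) f ys h f≡h =
      trans (count-++ P? (map (f Fin.zero ,_) ys) (cartesianProduct (tabulate (f ∘ Fin.suc)) ys))
        (cong₂ _+_ (trans (count-map-, (f Fin.zero) ys) (f≡h Fin.zero))
                   (count-cartesianProduct n (f ∘ Fin.suc) ys (h ∘ suc) (f≡h ∘ Fin.suc)))

  φ≡∑<coprime : ∀ n → φ n ≡ ∑< n (λ k → 𝟙 (gcd k n ≟ 1))
  φ≡∑<coprime zero        = refl
  φ≡∑<coprime n@(suc n-1) = begin
    φ n                                   ≡⟨ count-applyUpTo (λ k → gcd (suc k) n ≟ 1) n (λ k → k) ⟩
    ∑< n (coprime ∘ suc)                  ≡⟨ ∑<-suc n-1 (coprime ∘ suc) ⟩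
    ∑< n-1 (coprime ∘ suc) + coprime n    ≡⟨ +-comm _ (coprime n) ⟩
    coprime n + ∑< n-1 (coprime ∘ suc)    ≡⟨ cong (_+ ∑< n-1 (coprime ∘ suc)) gcd[n,n]≡gcd[0,n] ⟩
    coprime 0 + ∑< n-1 (coprime ∘ suc)    ∎
    where
    open ≡-Reasoning
    coprime : ℕ → ℕ
    coprime k = 𝟙 (gcd k n ≟ 1)
    gcd[n,n]≡gcd[0,n] : coprime n ≡ coprime 0
    gcd[n,n]≡gcd[0,n] = cong (λ d → 𝟙 (d ≟ 1)) (trans (gcd-of-divisor ∣-refl) (sym (gcd-identityˡ n)))

  gcd[iq+j,q]≡gcd[j,q] : ∀ i q j → gcd (i * q + j) q ≡ gcd j q
  gcd[iq+j,q]≡gcd[j,q] i q j = ∣-antisym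
    (gcd-greatest (∣m+n∣m⇒∣n (gcd[m,n]∣m (i * q + j) q) (∣n⇒∣m*n i (gcd[m,n]∣n (i * q + j) q))) (gcd[m,n]∣n (i * q + j) q))
    (gcd-greatest (∣m∣n⇒∣m+n (∣n⇒∣m*n i (gcd[m,n]∣n j q)) (gcd[m,n]∣m j q)) (gcd[m,n]∣n j q))

  ∑<-gcd-periodic : ∀ {M} n q r → M ≡ n * q → ∑< M (λ y → 𝟙 (gcd y q ≟ r)) ≡ n * ∑< q (λ j → 𝟙 (gcd j q ≟ r))
  ∑<-gcd-periodic n q r refl = begin
    ∑< (n * q) (λ y → 𝟙 (gcd y q ≟ r))                          ≡⟨ ∑<-* n q _ ⟩
    ∑< n (λ i → ∑< q (λ j → 𝟙 (gcd (i * q + j) q ≟ r)))         ≡⟨ ∑<-cong n (λ i _ → ∑<-cong q (λ j _ → cong (λ d → 𝟙 (d ≟ r)) (gcd[iq+j,q]≡gcd[j,q] i q j))) ⟩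
    ∑< n (λ _ → ∑< q (λ j → 𝟙 (gcd j q ≟ r)))                  ≡⟨ ∑<-const n _ ⟩
    n * ∑< q (λ j → 𝟙 (gcd j q ≟ r))                           ∎
    where open ≡-Reasoning

  -- Among x = iq + j < nq, gcd x (nq) = q forces j = 0, and then gcd (iq) (nq) = q · gcd i n.
  ∑<-gcd≡ : ∀ {M} n q → M ≡ n * q → q ≢ 0 → ∑< M (λ x → 𝟙 (gcd x M ≟ q)) ≡ φ n
  ∑<-gcd≡ n zero           _    q≢0 = ⊥-elim (q≢0 refl)
  ∑<-gcd≡ n q@(suc q-1) refl _   = begin
    ∑< (n * q) (λ x → 𝟙 (gcd x (n * q) ≟ q))                     ≡⟨ ∑<-* n q _ ⟩
    ∑< n (λ i → ∑< q (λ j → 𝟙 (gcd (i * q + j) (n * q) ≟ q)))    ≡⟨ ∑<-cong n (λ i _ → column i) ⟩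
    ∑< n (λ i → 𝟙 (gcd i n ≟ 1))                                  ≡⟨ φ≡∑<coprime n ⟨
    φ n                                                           ∎
    where
    open ≡-Reasoning
    column : ∀ i → ∑< q (λ j → 𝟙 (gcd (i * q + j) (n * q) ≟ q)) ≡ 𝟙 (gcd i n ≟ 1)
    column i = trans (cong₂ _+_ first (∑<-zero q-1 _ rest)) (+-identityʳ _)
      where
      gcd≡q*gcd : gcd (i * q + 0) (n * q) ≡ q * gcd i n
      gcd≡q*gcd = trans (cong₂ gcd (trans (+-identityʳ (i * q)) (*-comm i q)) (*-comm n q)) (sym (c*gcd[m,n]≡gcd[cm,cn] q i n))
      first : 𝟙 (gcd (i * q + 0) (n * q) ≟ q) ≡ 𝟙 (gcd i n ≟ 1)
      first = 𝟙-cong (gcd (i * q + 0) (n * q) ≟ q) (gcd i n ≟ 1)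
        (λ e → *-cancelˡ-≡ (gcd i n) 1 q (trans (sym gcd≡q*gcd) (trans e (sym (*-identityʳ q)))))
        (λ e → trans gcd≡q*gcd (trans (cong (q *_) e) (*-identityʳ q)))
      rest : ∀ j → j < q-1 → 𝟙 (gcd (i * q + suc j) (n * q) ≟ q) ≡ 0
      rest j j<q-1 with gcd (i * q + suc j) (n * q) ≟ q
      ... | no _  = refl
      ... | yes e = ⊥-elim (<-irrefl refl (<-≤-trans (s<s j<q-1) (∣⇒≤ q∣1+j)))
        where
        q∣1+j : q ∣ suc j
        q∣1+j = ∣m+n∣m⇒∣n (subst (_∣ i * q + suc j) e (gcd[m,n]∣m (i * q + suc j) (n * q))) (n∣m*n i)

module Invariants (N : ℕ) .{{_ : NonZero N}} where

  open Congruence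
  open import Data.Integer using (ℤ; +_; _+_; _-_; _*_; 0ℤ; 1ℤ)
  open import Data.Integer.Properties using (pos-*; *-assoc; *-comm; *-identityʳ)
  open import Data.Integer.Tactic.RingSolver using (solve-∀)
  import Data.Nat.Properties as ℕ
  import Data.Nat.Divisibility as ℕ
  import Data.Nat.DivMod as ℕ
  import Data.Nat.GCD as ℕ
  import Data.Nat.Coprimality as ℕ
  open import Data.Product using (∃; ∃₂; _×_; _,_; proj₁; proj₂)
  open import Relation.Binary.PropositionalEquality hiding ([_])
  open import Defs

  ≢0-cofactor : ∀ {n d c} → n ≢ 0 → n ≡ d ℕ.* c → c ≢ 0
  ≢0-cofactor {d = d} n≢0 n≡dc refl = n≢0 (trans n≡dc (ℕ.*-zeroʳ d))

  +-*-≡ : ∀ {n} p q → n ≡ p ℕ.* q → + n ≡ + p * + q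
  +-*-≡ p q e = trans (cong +_ e) (pos-* p q)

  triple-cong : ∀ {a a' b b' c c'} → a ≡ a' → b ≡ b' → c ≡ c' → [ a , b , c ] ≡ [ a' , b' , c' ]
  triple-cong refl refl refl = refl

  -- In the paper's notation, for (x, y): q₁ = r₁ x, q₂ = r₂ x y, x/q₁ = ξ x, y/q₂ = η x y,
  -- N/q₁ = N/r₁ x, q₁/q₂ = r₁/r₂ x y and u = u′ x y mod g x y.
  r₁ : ℕ → ℕ
  r₁ x = ℕ.gcd (x mod N) N

  r₂ : ℕ → ℕ → ℕ
  r₂ x y = ℕ.gcd (y mod N) (r₁ x)

  ξ : ℕ → ℕ
  ξ x = (x mod N) div r₁ x

  η : ℕ → ℕ → ℕ
  η x y = (y mod N) div r₂ x y

  N/r₁ : ℕ → ℕ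
  N/r₁ x = N div r₁ x

  r₁/r₂ : ℕ → ℕ → ℕ
  r₁/r₂ x y = r₁ x div r₂ x y

  g : ℕ → ℕ → ℕ
  g x y = gT N (r₁ x) (r₂ x y)

  u′ : ℕ → ℕ → ℕ
  u′ x y = ξ x ℕ.* η x y

  module _ (x : ℕ) where

    r₁∣N : r₁ x ℕ.∣ N
    r₁∣N = ℕ.gcd[m,n]∣n (x mod N) N

    r₁≢0 : r₁ x ≢ 0
    r₁≢0 r₁≡0 = ℕ.≢-nonZero⁻¹ N (ℕ.gcd[m,n]≡0⇒n≡0 (x mod N) r₁≡0)

    x̂≡r₁ξ : x mod N ≡ r₁ x ℕ.* ξ x
    x̂≡r₁ξ = n≡[n/d]*d (ℕ.gcd[m,n]∣m (x mod N) N)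

    N≡r₁*N/r₁ : N ≡ r₁ x ℕ.* N/r₁ x
    N≡r₁*N/r₁ = n≡[n/d]*d r₁∣N

    ξ⊥N/r₁ : ℕ.gcd (ξ x) (N/r₁ x) ≡ 1
    ξ⊥N/r₁ = cofactors-coprime (x mod N) N (ℕ.≢-nonZero⁻¹ N)

  module _ (x y : ℕ) where

    r₂∣r₁ : r₂ x y ℕ.∣ r₁ x
    r₂∣r₁ = ℕ.gcd[m,n]∣n (y mod N) (r₁ x)

    r₂≢0 : r₂ x y ≢ 0
    r₂≢0 r₂≡0 = r₁≢0 x (ℕ.gcd[m,n]≡0⇒n≡0 (y mod N) r₂≡0)

    ŷ≡r₂η : y mod N ≡ r₂ x y ℕ.* η x y
    ŷ≡r₂η = n≡[n/d]*d (ℕ.gcd[m,n]∣m (y mod N) (r₁ x))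

    r₁≡r₂*r₁/r₂ : r₁ x ≡ r₂ x y ℕ.* r₁/r₂ x y
    r₁≡r₂*r₁/r₂ = n≡[n/d]*d r₂∣r₁

    η⊥r₁/r₂ : ℕ.gcd (η x y) (r₁/r₂ x y) ≡ 1
    η⊥r₁/r₂ = cofactors-coprime (y mod N) (r₁ x) (r₁≢0 x)

    r₁/r₂≢0 : r₁/r₂ x y ≢ 0
    r₁/r₂≢0 = ≢0-cofactor {r₁ x} {r₂ x y} (r₁≢0 x) r₁≡r₂*r₁/r₂

    g≢0 : g x y ≢ 0
    g≢0 g≡0 = r₁/r₂≢0 (ℕ.gcd[m,n]≡0⇒n≡0 (N/r₁ x) g≡0)

    g∣N/r₁ : g x y ℕ.∣ N/r₁ x
    g∣N/r₁ = ℕ.gcd[m,n]∣m (N/r₁ x) (r₁/r₂ x y)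

    g∣N : g x y ℕ.∣ N
    g∣N = ℕ.∣-trans g∣N/r₁ (ℕ.divides (r₁ x) (N≡r₁*N/r₁ x))

    g∣r₁/r₂ : g x y ℕ.∣ r₁/r₂ x y
    g∣r₁/r₂ = ℕ.gcd[m,n]∣n (N/r₁ x) (r₁/r₂ x y)

    cls∈𝒪 : InO N (cls N (x , y))
    cls∈𝒪 = r₂∣r₁ , r₁∣N x , mod<divisor (u′ x y) (ℕ.n≢0⇒n>0 g≢0) , coprime⇒gcd≡1
      (coprime-resp-≋ (mod≋ (u′ x y) (g x y)) (subst (λ z → Coprime z (+ g x y)) (sym (pos-* (ξ x) (η x y)))
        (coprime-* (coprime-divisor {n = N/r₁ x} g∣N/r₁ (gcd≡1⇒coprime {ξ x} {N/r₁ x} (ξ⊥N/r₁ x)))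
                   (coprime-divisor {n = r₁/r₂ x y} g∣r₁/r₂ (gcd≡1⇒coprime {η x y} {r₁/r₂ x y} η⊥r₁/r₂)))))

  ≋-reduce : ∀ x → + x ≋ + (x mod N) [ + N ]
  ≋-reduce x = ≋-sym (mod≋ x N)

  module Triangular {x y x' y' : ℕ} {a b d ā d̄ : ℤ}
    (aā≋1 : a * ā ≋ 1ℤ [ + N ]) (dd̄≋1 : d * d̄ ≋ 1ℤ [ + N ])
    (x'≋xa : + x' ≋ + x * a [ + N ]) (y'≋xb+yd : + y' ≋ + x * b + + y * d [ + N ]) where

    private
      X  = + (x mod N)
      Y  = + (y mod N)
      X' = + (x' mod N)
      Y' = + (y' mod N)

      X'≋Xa : X' ≋ X * a [ + N ]
      X'≋Xa = begin
        X'        ≈⟨ ≋-reduce x' ⟨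
        + x'      ≈⟨ x'≋xa ⟩
        + x * a   ≈⟨ *-congʳ a (≋-reduce x) ⟩
        X * a     ∎
        where open ≋-Reasoning (+ N)

      Y'≋Xb+Yd : Y' ≋ X * b + Y * d [ + N ]
      Y'≋Xb+Yd = begin
        Y'                ≈⟨ ≋-reduce y' ⟨
        + y'              ≈⟨ y'≋xb+yd ⟩
        + x * b + + y * d ≈⟨ +-cong (*-congʳ b (≋-reduce x)) (*-congʳ d (≋-reduce y)) ⟩
        X * b + Y * d     ∎
        where open ≋-Reasoning (+ N)

    r₁-invariant : r₁ x' ≡ r₁ x
    r₁-invariant = gcd-resp-unit {x mod N} {x' mod N} X'≋Xa aā≋1

    private
      Y'≋Yd : Y' ≋ Y * d [ + r₁ x ]
      Y'≋Yd = begin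
        Y'            ≈⟨ ≋-divisor (r₁∣N x) Y'≋Xb+Yd ⟩
        X * b + Y * d ≈⟨ +-congʳ (Y * d) (*-congʳ b (∣⇒≋0 (ℕ.gcd[m,n]∣m (x mod N) N))) ⟩
        0ℤ * b + Y * d ≡⟨ cancel b (Y * d) ⟩
        Y * d         ∎
        where
        open ≋-Reasoning (+ r₁ x)
        cancel : ∀ b z → 0ℤ * b + z ≡ z
        cancel = solve-∀

    r₂-invariant : r₂ x' y' ≡ r₂ x y
    r₂-invariant = trans (cong (ℕ.gcd (y' mod N)) r₁-invariant)
      (gcd-resp-unit {y mod N} {y' mod N} Y'≋Yd (≋-divisor (r₁∣N x) dd̄≋1))

    private
      ξ' = + ξ x'
      η' = + η x' y'
      X≡ : X ≡ + r₁ x * + ξ x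
      X≡ = +-*-≡ (r₁ x) (ξ x) (x̂≡r₁ξ x)
      X'≡ : X' ≡ + r₁ x * ξ'
      X'≡ = +-*-≡ (r₁ x) (ξ x') (trans (x̂≡r₁ξ x') (cong (ℕ._* ξ x') r₁-invariant))
      Y≡ : Y ≡ + r₂ x y * + η x y
      Y≡ = +-*-≡ (r₂ x y) (η x y) (ŷ≡r₂η x y)
      Y'≡ : Y' ≡ + r₂ x y * η'
      Y'≡ = +-*-≡ (r₂ x y) (η x' y') (trans (ŷ≡r₂η x' y') (cong (ℕ._* η x' y') r₂-invariant))
      R₁≡ : + r₁ x ≡ + r₂ x y * + r₁/r₂ x y
      R₁≡ = +-*-≡ (r₂ x y) (r₁/r₂ x y) (r₁≡r₂*r₁/r₂ x y)
      N≡ : + N ≡ + r₁ x * + N/r₁ x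
      N≡ = +-*-≡ (r₁ x) (N/r₁ x) (N≡r₁*N/r₁ x)

      ξ'≋ξa : ξ' ≋ + ξ x * a [ + N/r₁ x ]
      ξ'≋ξa = *-cancelˡ (+ r₁ x) {{ℕ.≢-nonZero (r₁≢0 x)}} (begin
        + r₁ x * ξ'          ≡⟨ X'≡ ⟨
        X'                   ≈⟨ ≋-resp-modulus N≡ X'≋Xa ⟩
        X * a                ≡⟨ cong (_* a) X≡ ⟩
        + r₁ x * + ξ x * a   ≡⟨ *-assoc (+ r₁ x) (+ ξ x) a ⟩
        + r₁ x * (+ ξ x * a) ∎)
        where open ≋-Reasoning (+ r₁ x * + N/r₁ x)

      η'≋mξb+ηd : η' ≋ + r₁/r₂ x y * + ξ x * b + + η x y * d [ + r₁/r₂ x y * + N/r₁ x ]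
      η'≋mξb+ηd = *-cancelˡ (+ r₂ x y) {{ℕ.≢-nonZero (r₂≢0 x y)}} (begin
        + r₂ x y * η'  ≡⟨ Y'≡ ⟨
        Y'             ≈⟨ ≋-resp-modulus N≡′ Y'≋Xb+Yd ⟩
        X * b + Y * d  ≡⟨ cong₂ (λ u v → u * b + v * d) (trans X≡ (cong (_* + ξ x) R₁≡)) Y≡ ⟩
        + r₂ x y * + r₁/r₂ x y * + ξ x * b + + r₂ x y * + η x y * d  ≡⟨ factor (+ r₂ x y) (+ r₁/r₂ x y) (+ ξ x) b (+ η x y) d ⟩
        + r₂ x y * (+ r₁/r₂ x y * + ξ x * b + + η x y * d)          ∎)
        where
        open ≋-Reasoning (+ r₂ x y * (+ r₁/r₂ x y * + N/r₁ x))
        factor : ∀ r m ξ b η d → r * m * ξ * b + r * η * d ≡ r * (m * ξ * b + η * d)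
        factor = solve-∀
        N≡′ : + N ≡ + r₂ x y * (+ r₁/r₂ x y * + N/r₁ x)
        N≡′ = trans N≡ (trans (cong (_* + N/r₁ x) R₁≡) (*-assoc (+ r₂ x y) _ _))

      ξ'≋ξa[g] : ξ' ≋ + ξ x * a [ + g x y ]
      ξ'≋ξa[g] = ≋-divisor (g∣N/r₁ x y) ξ'≋ξa

      η'≋ηd[g] : η' ≋ + η x y * d [ + g x y ]
      η'≋ηd[g] = begin
        η'                                       ≈⟨ ≋-divisor g∣mn₁ (≋-resp-modulus (sym (pos-* (r₁/r₂ x y) (N/r₁ x))) η'≋mξb+ηd) ⟩
        + r₁/r₂ x y * + ξ x * b + + η x y * d    ≈⟨ +-congʳ (+ η x y * d) (*-congʳ b (*-congʳ (+ ξ x) (∣⇒≋0 (g∣r₁/r₂ x y)))) ⟩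
        0ℤ * + ξ x * b + + η x y * d             ≡⟨ cancel (+ ξ x) b _ ⟩
        + η x y * d                              ∎
        where
        open ≋-Reasoning (+ g x y)
        g∣mn₁ : g x y ℕ.∣ r₁/r₂ x y ℕ.* N/r₁ x
        g∣mn₁ = ℕ.∣m⇒∣m*n (N/r₁ x) (g∣r₁/r₂ x y)
        cancel : ∀ ξ b z → 0ℤ * ξ * b + z ≡ z
        cancel = solve-∀

    u′-scaled : + u′ x' y' ≋ + u′ x y * (a * d) [ + g x y ]
    u′-scaled = begin
      + u′ x' y'                   ≡⟨ pos-* (ξ x') (η x' y') ⟩
      ξ' * η'                      ≈⟨ *-cong ξ'≋ξa[g] η'≋ηd[g] ⟩
      + ξ x * a * (+ η x y * d)    ≡⟨ regroup (+ ξ x) a (+ η x y) d ⟩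
      + ξ x * + η x y * (a * d)    ≡⟨ cong (_* (a * d)) (pos-* (ξ x) (η x y)) ⟨
      + u′ x y * (a * d)           ∎
      where
      open ≋-Reasoning (+ g x y)
      regroup : ∀ ξ a η d → ξ * a * (η * d) ≡ ξ * η * (a * d)
      regroup = solve-∀

    g-invariant : g x' y' ≡ g x y
    g-invariant = cong₂ (gT N) r₁-invariant r₂-invariant

    cls-invariant : a * d ≋ 1ℤ [ + N ] → cls N (x' , y') ≡ cls N (x , y)
    cls-invariant ad≋1 = triple-cong r₁-invariant r₂-invariant (begin
      u′ x' y' mod g x' y' ≡⟨ cong (u′ x' y' mod_) g-invariant ⟩
      u′ x' y' mod g x y   ≡⟨ ≋⇒mod≡ (g x y) (≋-trans u′-scaled u′ad≋u′) ⟩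
      u′ x y mod g x y     ∎)
      where
      open ≡-Reasoning
      u′ad≋u′ : + u′ x y * (a * d) ≋ + u′ x y [ + g x y ]
      u′ad≋u′ = ≋-trans (*-congˡ (+ u′ x y) (≋-divisor (g∣N x y) ad≋1)) (≋-reflexive (*-identityʳ (+ u′ x y)))

  -- Γ₀(N) acts on (ℤ/N)² through upper triangular matrices (a b; 0 d) with ad ≡ 1 mod N.
  Triangular-related : ℕ × ℕ → ℕ × ℕ → Set
  Triangular-related (x , y) (x' , y') = ∃ λ a → ∃₂ λ b d →
    a * d ≋ 1ℤ [ + N ] × + x' ≋ + x * a [ + N ] × + y' ≋ + x * b + + y * d [ + N ]

  module Injectivity {x y x' y' : ℕ} (same : cls N (x , y) ≡ cls N (x' , y')) where

    private
      r₁≡ : r₁ x ≡ r₁ x'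
      r₁≡ = cong q₁ same
      r₂≡ : r₂ x y ≡ r₂ x' y'
      r₂≡ = cong q₂ same
      n₁ = N/r₁ x
      m  = r₁/r₂ x y
      ξ₀ = + ξ x
      η₀ = + η x y
      ξ' = + ξ x'
      η' = + η x' y'

      ξη≋ξ'η' : ξ₀ * η₀ ≋ ξ' * η' [ + g x y ]
      ξη≋ξ'η' = begin
        ξ₀ * η₀      ≡⟨ pos-* (ξ x) (η x y) ⟨
        + u′ x y     ≈⟨ mod≡⇒≋ (g x y) (trans (cong u same) (cong (u′ x' y' mod_) (sym (cong₂ (gT N) r₁≡ r₂≡)))) ⟩
        + u′ x' y'   ≡⟨ pos-* (ξ x') (η x' y') ⟩
        ξ' * η'      ∎
        where open ≋-Reasoning (+ g x y)

      ξ⊥n₁ : Coprime ξ₀ (+ n₁)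
      ξ⊥n₁ = gcd≡1⇒coprime {ξ x} {n₁} (ξ⊥N/r₁ x)
      ξ'⊥n₁ : Coprime ξ' (+ n₁)
      ξ'⊥n₁ = gcd≡1⇒coprime {ξ x'} {n₁} (subst (λ r → ℕ.gcd (ξ x') (N div r) ≡ 1) (sym r₁≡) (ξ⊥N/r₁ x'))
      η⊥m : Coprime η₀ (+ m)
      η⊥m = gcd≡1⇒coprime {η x y} {m} (η⊥r₁/r₂ x y)
      η'⊥m : Coprime η' (+ m)
      η'⊥m = gcd≡1⇒coprime {η x' y'} {m} (subst₂ (λ r r' → ℕ.gcd (η x' y') (r div r') ≡ 1) (sym r₁≡) (sym r₂≡) (η⊥r₁/r₂ x' y'))

      ξ̄ = proj₁ (coprime⇒inverse ξ⊥n₁)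
      ξξ̄≋1 : ξ₀ * ξ̄ ≋ 1ℤ [ + n₁ ]
      ξξ̄≋1 = proj₂ (coprime⇒inverse ξ⊥n₁)

      a₀ = ξ' * ξ̄

      η≋a₀η' : η₀ ≋ a₀ * η' [ + g x y ]
      η≋a₀η' = begin
        η₀               ≡⟨ *-identityʳ η₀ ⟨
        η₀ * 1ℤ          ≈⟨ *-congˡ η₀ (≋-divisor (g∣N/r₁ x y) ξξ̄≋1) ⟨
        η₀ * (ξ₀ * ξ̄)    ≡⟨ regroup₁ η₀ ξ₀ ξ̄ ⟩
        ξ₀ * η₀ * ξ̄      ≈⟨ *-congʳ ξ̄ ξη≋ξ'η' ⟩
        ξ' * η' * ξ̄      ≡⟨ regroup₂ ξ' η' ξ̄ ⟩
        a₀ * η'          ∎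
        where
        open ≋-Reasoning (+ g x y)
        regroup₁ : ∀ η ξ ξ̄ → η * (ξ * ξ̄) ≡ ξ * η * ξ̄
        regroup₁ = solve-∀
        regroup₂ : ∀ ξ' η' ξ̄ → ξ' * η' * ξ̄ ≡ ξ' * ξ̄ * η'
        regroup₂ = solve-∀

      lifted = lift-solution {n₁} {m} {a₀} {η'} {η₀} (r₁/r₂≢0 x y) η'⊥m η≋a₀η'
      a₁ = proj₁ lifted
      a₁≋a₀ : a₁ ≋ a₀ [ + n₁ ]
      a₁≋a₀ = proj₁ (proj₂ lifted)
      a₁η'≋η : a₁ * η' ≋ η₀ [ + m ]
      a₁η'≋η = proj₂ (proj₂ lifted)

      a₁⊥n₁m : Coprime a₁ (+ (n₁ ℕ.* m))
      a₁⊥n₁m = subst (Coprime a₁) (sym (pos-* n₁ m)) (coprime-*ʳ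
        (coprime-resp-≋ a₁≋a₀ (coprime-* ξ'⊥n₁ (inverse⇒coprime (≋-trans (≋-reflexive (*-comm ξ̄ ξ₀)) ξξ̄≋1))))
        (coprime-*⇒coprimeˡ (coprime-resp-≋ a₁η'≋η η⊥m)))

      N≡r₂mn₁ : N ≡ r₂ x y ℕ.* (n₁ ℕ.* m)
      N≡r₂mn₁ = trans (N≡r₁*N/r₁ x) (trans (cong (ℕ._* n₁) (r₁≡r₂*r₁/r₂ x y)) (trans (ℕ.*-assoc (r₂ x y) m n₁) (cong (r₂ x y ℕ.*_) (ℕ.*-comm m n₁))))

      unit = lift-unit (n₁ ℕ.* m) N (ℕ.divides (r₂ x y) N≡r₂mn₁) a₁⊥n₁m
      s = proj₁ unit
      s≋a₁ : + s ≋ a₁ [ + (n₁ ℕ.* m) ]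
      s≋a₁ = proj₁ (proj₂ unit)
      s̄ = proj₁ (coprime⇒inverse (proj₂ (proj₂ unit)))
      ss̄≋1 : + s * s̄ ≋ 1ℤ [ + N ]
      ss̄≋1 = proj₂ (coprime⇒inverse (proj₂ (proj₂ unit)))

      X  = + (x mod N)
      Y  = + (y mod N)
      N≡ : + N ≡ + r₁ x * + n₁
      N≡ = +-*-≡ (r₁ x) n₁ (N≡r₁*N/r₁ x)
      X≡ : X ≡ + r₁ x * ξ₀
      X≡ = +-*-≡ (r₁ x) (ξ x) (x̂≡r₁ξ x)

      ξs≋ξ' : ξ₀ * + s ≋ ξ' [ + n₁ ]
      ξs≋ξ' = begin
        ξ₀ * + s         ≈⟨ *-congˡ ξ₀ (≋-divisor (ℕ.m∣m*n m) s≋a₁) ⟩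
        ξ₀ * a₁          ≈⟨ *-congˡ ξ₀ a₁≋a₀ ⟩
        ξ₀ * (ξ' * ξ̄)    ≡⟨ regroup ξ₀ ξ' ξ̄ ⟩
        ξ' * (ξ₀ * ξ̄)    ≈⟨ *-congˡ ξ' ξξ̄≋1 ⟩
        ξ' * 1ℤ          ≡⟨ *-identityʳ ξ' ⟩
        ξ'               ∎
        where
        open ≋-Reasoning (+ n₁)
        regroup : ∀ ξ ξ' ξ̄ → ξ * (ξ' * ξ̄) ≡ ξ' * (ξ * ξ̄)
        regroup = solve-∀

      x'≋xs : + x' ≋ + x * + s [ + N ]
      x'≋xs = begin
        + x'                 ≈⟨ ≋-reduce x' ⟩
        + (x' mod N)         ≡⟨ +-*-≡ (r₁ x) (ξ x') (trans (x̂≡r₁ξ x') (cong (ℕ._* ξ x') (sym r₁≡))) ⟩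
        + r₁ x * ξ'          ≈⟨ ≋-resp-modulus (sym N≡) (*-scaleˡ (+ r₁ x) ξs≋ξ') ⟨
        + r₁ x * (ξ₀ * + s)  ≡⟨ *-assoc (+ r₁ x) ξ₀ (+ s) ⟨
        + r₁ x * ξ₀ * + s    ≡⟨ cong (_* + s) X≡ ⟨
        X * + s              ≈⟨ *-congʳ (+ s) (≋-reduce x) ⟨
        + x * + s            ∎
        where open ≋-Reasoning (+ N)

      η'≋ηs̄ : η' ≋ η₀ * s̄ [ + m ]
      η'≋ηs̄ = divide-by-unit
        (≋-sym (≋-trans (≋-reflexive (*-comm η' (+ s))) (≋-trans (*-congʳ η' (≋-divisor (ℕ.n∣m*n n₁) s≋a₁)) a₁η'≋η)))
        (≋-divisor (ℕ.∣-trans (ℕ.n∣m*n n₁) (ℕ.divides (r₂ x y) N≡r₂mn₁)) ss̄≋1)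

      k₂ = _≋_[_].quotient η'≋ηs̄

      r₁≋Xξ̄ : + r₁ x ≋ X * ξ̄ [ + N ]
      r₁≋Xξ̄ = begin
        + r₁ x               ≡⟨ *-identityʳ (+ r₁ x) ⟨
        + r₁ x * 1ℤ          ≈⟨ ≋-resp-modulus (sym N≡) (*-scaleˡ (+ r₁ x) ξξ̄≋1) ⟨
        + r₁ x * (ξ₀ * ξ̄)    ≡⟨ *-assoc (+ r₁ x) ξ₀ ξ̄ ⟨
        + r₁ x * ξ₀ * ξ̄      ≡⟨ cong (_* ξ̄) X≡ ⟨
        X * ξ̄                ∎
        where open ≋-Reasoning (+ N)

      y'≋xb+ys̄ : + y' ≋ + x * (ξ̄ * k₂) + + y * s̄ [ + N ]
      y'≋xb+ys̄ = begin
        + y'                                 ≈⟨ ≋-reduce y' ⟩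
        + (y' mod N)                         ≡⟨ +-*-≡ (r₂ x y) (η x' y') (trans (ŷ≡r₂η x' y') (cong (ℕ._* η x' y') (sym r₂≡))) ⟩
        + r₂ x y * η'                        ≡⟨ cong (+ r₂ x y *_) (≡+quotient η'≋ηs̄) ⟩
        + r₂ x y * (η₀ * s̄ + k₂ * + m)       ≡⟨ expand (+ r₂ x y) η₀ s̄ k₂ (+ m) ⟩
        + r₂ x y * + m * k₂ + + r₂ x y * η₀ * s̄ ≡⟨ cong₂ (λ u v → u * k₂ + v * s̄) (sym (+-*-≡ (r₂ x y) m (r₁≡r₂*r₁/r₂ x y))) (sym (+-*-≡ (r₂ x y) (η x y) (ŷ≡r₂η x y))) ⟩
        + r₁ x * k₂ + Y * s̄                  ≈⟨ +-congʳ (Y * s̄) (*-congʳ k₂ r₁≋Xξ̄) ⟩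
        X * ξ̄ * k₂ + Y * s̄                   ≡⟨ cong (_+ Y * s̄) (*-assoc X ξ̄ k₂) ⟩
        X * (ξ̄ * k₂) + Y * s̄                 ≈⟨ +-cong (*-congʳ (ξ̄ * k₂) (≋-reduce x)) (*-congʳ s̄ (≋-reduce y)) ⟨
        + x * (ξ̄ * k₂) + + y * s̄             ∎
        where
        open ≋-Reasoning (+ N)
        expand : ∀ r η s̄ k m → r * (η * s̄ + k * m) ≡ r * m * k + r * η * s̄
        expand = solve-∀

    triangular-related : Triangular-related (x , y) (x' , y')
    triangular-related = + s , ξ̄ * k₂ , s̄ , ss̄≋1 , x'≋xs , y'≋xb+ys̄

module Classification (N : ℕ) .{{_ : NonZero N}} where

  open Congruence
  open Invariants N
  open import Data.Integer using (ℤ; +_; _+_; _-_; _*_; 0ℤ; 1ℤ)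
  open import Data.Integer.Properties using (pos-*; *-comm; *-assoc; *-identityˡ; *-identityʳ; +-identityʳ)
  import Data.Integer.Divisibility.Signed as ℤ
  open import Data.Integer.Tactic.RingSolver using (solve; solve-∀)
  import Data.Nat.Properties as ℕ
  import Data.Nat.Divisibility as ℕ
  import Data.Nat.GCD as ℕ
  open import Data.Fin using (Fin; toℕ; fromℕ<)
  open import Data.Fin.Properties using (toℕ-fromℕ<)
  open import Data.List using ([]; _∷_)
  open import Data.Product using (∃; _×_; _,_; proj₁; proj₂)
  open import Relation.Binary.PropositionalEquality hiding ([_])
  open import Defs

  ≋⇒≡[mod] : ∀ {i j} → i ≋ j [ + N ] → i ≡[mod N ] j
  ≋⇒≡[mod] (t ,≋ e) = ℤ.∣⇒∣ᵤ (ℤ.divides t e)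

  ≡[mod]⇒≋ : ∀ {i j} → i ≡[mod N ] j → i ≋ j [ + N ]
  ≡[mod]⇒≋ N∣i-j with ℤ.∣ᵤ⇒∣ N∣i-j
  ... | ℤ.divides t e = t ,≋ e

  orbit⇒triangular : ∀ {p p'} → SameOrbit p p' → Triangular-related (lift p) (lift p')
  orbit⇒triangular {x , y} {x' , y'} (mat a b c d det N∣c , x'≡ , y'≡) = a , b , d , ad≋1 , x'≋xa , ≋-sym (≡[mod]⇒≋ y'≡)
    where
    X = + toℕ x
    Y = + toℕ y
    c≋0 : c ≋ 0ℤ [ + N ]
    c≋0 with ℤ.∣ᵤ⇒∣ N∣c
    ... | ℤ.divides q c≡qN = q ,≋ trans (+-identityʳ c) c≡qN
    ad≋1 : a * d ≋ 1ℤ [ + N ]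
    ad≋1 = begin
      a * d                ≡⟨ solve (a ∷ b ∷ c ∷ d ∷ []) ⟩
      (a * d - b * c) + b * c ≡⟨ cong (_+ b * c) det ⟩
      1ℤ + b * c           ≈⟨ +-congˡ 1ℤ (*-congˡ b c≋0) ⟩
      1ℤ + b * 0ℤ          ≡⟨ solve (b ∷ []) ⟩
      1ℤ                   ∎
      where open ≋-Reasoning (+ N)
    x'≋xa : + toℕ x' ≋ X * a [ + N ]
    x'≋xa = begin
      + toℕ x'         ≈⟨ ≡[mod]⇒≋ x'≡ ⟨
      X * a + Y * c    ≈⟨ +-congˡ (X * a) (*-congˡ Y c≋0) ⟩
      X * a + Y * 0ℤ   ≡⟨ drop (X * a) Y ⟩
      X * a            ∎
      where
      open ≋-Reasoning (+ N)
      drop : ∀ u Y → u + Y * 0ℤ ≡ u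
      drop = solve-∀

  -- With ad − 1 = kN, this matrix has determinant ad − kN = 1 and reduces to (a b; 0 d) mod N.
  triangular⇒orbit : ∀ {p p'} → Triangular-related (lift p) (lift p') → SameOrbit p p'
  triangular⇒orbit {x , y} {x' , y'} (a , b , d , ad≋1@(k ,≋ ad-1≡kN) , x'≋xa , y'≋xb+yd) =
    mat a B n D det (ℕ.∣-refl {N}) , ≋⇒≡[mod] x-entry , ≋⇒≡[mod] y-entry
    where
    n = + N
    X = + toℕ x
    Y = + toℕ y
    B = a * d * (b - k) + k
    D = n * d * (b - k) + d
    det : a * D - B * n ≡ 1ℤ
    det = begin
      a * D - B * n              ≡⟨ expand a d b k n ⟩
      (a * d - 1ℤ) - k * n + 1ℤ  ≡⟨ cong (λ z → z - k * n + 1ℤ) ad-1≡kN ⟩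
      k * n - k * n + 1ℤ         ≡⟨ cancel (k * n) ⟩
      1ℤ                         ∎
      where
      open ≡-Reasoning
      expand : ∀ a d b k n → a * (n * d * (b - k) + d) - (a * d * (b - k) + k) * n ≡ (a * d - 1ℤ) - k * n + 1ℤ
      expand = solve-∀
      cancel : ∀ z → z - z + 1ℤ ≡ 1ℤ
      cancel = solve-∀
    x-entry : X * a + Y * n ≋ + toℕ x' [ n ]
    x-entry = begin
      X * a + Y * n    ≈⟨ +-congˡ (X * a) (*-congˡ Y (modulus≋0 n)) ⟩
      X * a + Y * 0ℤ   ≡⟨ drop (X * a) Y ⟩
      X * a            ≈⟨ x'≋xa ⟨
      + toℕ x'         ∎
      where
      open ≋-Reasoning n
      drop : ∀ u Y → u + Y * 0ℤ ≡ u
      drop = solve-∀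
    B≋b : B ≋ b [ n ]
    B≋b = begin
      a * d * (b - k) + k  ≈⟨ +-congʳ k (*-congʳ (b - k) ad≋1) ⟩
      1ℤ * (b - k) + k     ≡⟨ solve (b ∷ k ∷ []) ⟩
      b                    ∎
      where open ≋-Reasoning n
    D≋d : D ≋ d [ n ]
    D≋d = begin
      n * d * (b - k) + d  ≈⟨ +-congʳ d (*-congʳ (b - k) (*-congʳ d (modulus≋0 n))) ⟩
      0ℤ * d * (b - k) + d ≡⟨ solve (d ∷ b ∷ k ∷ []) ⟩
      d                    ∎
      where open ≋-Reasoning n
    y-entry : X * B + Y * D ≋ + toℕ y' [ n ]
    y-entry = ≋-trans (+-cong (*-congˡ X B≋b) (*-congˡ Y D≋d)) (≋-sym y'≋xb+yd)

  cls-orbit-invariant : ∀ {p p'} → SameOrbit p p' → cls N (lift p) ≡ cls N (lift p')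
  cls-orbit-invariant {x , y} {x' , y'} orbit = invariant (orbit⇒triangular {x , y} {x' , y'} orbit)
    where
    invariant : Triangular-related (toℕ x , toℕ y) (toℕ x' , toℕ y') → cls N (toℕ x , toℕ y) ≡ cls N (toℕ x' , toℕ y')
    invariant (a , b , d , ad≋1 , x'≋xa , y'≋xb+yd) = sym (Triangular.cls-invariant {toℕ x} {toℕ y} {toℕ x'} {toℕ y'} {a} {b} {d} {d} {a}
      ad≋1 (≋-trans (≋-reflexive (*-comm d a)) ad≋1) x'≋xa y'≋xb+yd ad≋1)

  same-cls⇒orbit : ∀ {p p'} → cls N (lift p) ≡ cls N (lift p') → SameOrbit p p'
  same-cls⇒orbit {p} {p'} same = triangular⇒orbit {p} {p'} (Injectivity.triangular-related same)

  module Representative {q₁ q₂ u : ℕ} (t∈𝒪 : InO N [ q₁ , q₂ , u ]) where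

    private
      q₂∣q₁ = proj₁ t∈𝒪
      q₁∣N  = proj₁ (proj₂ t∈𝒪)
      n₁ = N div q₁
      m  = q₁ div q₂
      g′ = gT N q₁ q₂
      N≡q₁n₁ : N ≡ q₁ ℕ.* n₁
      N≡q₁n₁ = n≡[n/d]*d q₁∣N
      q₁≡q₂m : q₁ ≡ q₂ ℕ.* m
      q₁≡q₂m = n≡[n/d]*d q₂∣q₁
      q₁≢0 : q₁ ≢ 0
      q₁≢0 refl = ℕ.≢-nonZero⁻¹ N N≡q₁n₁
      q₂≢0 : q₂ ≢ 0
      q₂≢0 refl = q₁≢0 q₁≡q₂m
      g′∣n₁ : g′ ℕ.∣ n₁
      g′∣n₁ = ℕ.gcd[m,n]∣m n₁ m
      g′∣m : g′ ℕ.∣ m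
      g′∣m = ℕ.gcd[m,n]∣n n₁ m

    representative-exists : ∃ λ v → v mod g′ ≡ u × ℕ.gcd v m ≡ 1
    representative-exists = v , trans (≋⇒mod≡ g′ v≋u) (mod-small (proj₁ (proj₂ (proj₂ t∈𝒪)))) , coprime⇒gcd≡1 v⊥m
      where
      instance
        _ : NonZero m
        _ = ℕ.≢-nonZero (≢0-cofactor {q₁} {q₂} q₁≢0 q₁≡q₂m)
      lifted = lift-unit g′ m g′∣m (gcd≡1⇒coprime {u} {g′} (proj₂ (proj₂ (proj₂ t∈𝒪))))
      v = proj₁ lifted
      v≋u : + v ≋ + u [ + g′ ]
      v≋u = proj₁ (proj₂ lifted)
      v⊥m : Coprime (+ v) (+ m)
      v⊥m = proj₂ (proj₂ lifted)

    module _ {v : ℕ} (v≡u : v mod g′ ≡ u) (v⊥m : ℕ.gcd v m ≡ 1) where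

      private
        r₁≡q₁ : r₁ q₁ ≡ q₁
        r₁≡q₁ = trans (gcd-mod q₁ (ℕ.∣-refl {N})) (gcd-of-divisor q₁∣N)

        r₂≡q₂ : r₂ q₁ (q₂ ℕ.* v) ≡ q₂
        r₂≡q₂ = begin
          ℕ.gcd ((q₂ ℕ.* v) mod N) (r₁ q₁)  ≡⟨ cong (ℕ.gcd ((q₂ ℕ.* v) mod N)) r₁≡q₁ ⟩
          ℕ.gcd ((q₂ ℕ.* v) mod N) q₁       ≡⟨ gcd-mod (q₂ ℕ.* v) q₁∣N ⟩
          ℕ.gcd (q₂ ℕ.* v) q₁               ≡⟨ cong (ℕ.gcd (q₂ ℕ.* v)) q₁≡q₂m ⟩
          ℕ.gcd (q₂ ℕ.* v) (q₂ ℕ.* m)       ≡⟨ ℕ.c*gcd[m,n]≡gcd[cm,cn] q₂ v m ⟨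
          q₂ ℕ.* ℕ.gcd v m                  ≡⟨ cong (q₂ ℕ.*_) v⊥m ⟩
          q₂ ℕ.* 1                          ≡⟨ ℕ.*-identityʳ q₂ ⟩
          q₂                                ∎
          where open ≡-Reasoning

        ξ≋1 : + ξ q₁ ≋ 1ℤ [ + g′ ]
        ξ≋1 = ≋-divisor g′∣n₁ (*-cancelˡ (+ q₁) {{ℕ.≢-nonZero q₁≢0}} (begin
          + q₁ * + ξ q₁   ≡⟨ +-*-≡ q₁ (ξ q₁) (trans (x̂≡r₁ξ q₁) (cong (ℕ._* ξ q₁) r₁≡q₁)) ⟨
          + (q₁ mod N)    ≈⟨ ≋-resp-modulus (+-*-≡ q₁ n₁ N≡q₁n₁) (mod≋ q₁ N) ⟩
          + q₁            ≡⟨ *-identityʳ (+ q₁) ⟨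
          + q₁ * 1ℤ       ∎))
          where open ≋-Reasoning (+ q₁ * + n₁)

        η≋v : + η q₁ (q₂ ℕ.* v) ≋ + v [ + g′ ]
        η≋v = ≋-divisor (ℕ.∣m⇒∣m*n n₁ g′∣m) (≋-resp-modulus (sym (pos-* m n₁)) (*-cancelˡ (+ q₂) {{ℕ.≢-nonZero q₂≢0}} (begin
          + q₂ * + η q₁ (q₂ ℕ.* v) ≡⟨ +-*-≡ q₂ (η q₁ (q₂ ℕ.* v)) (trans (ŷ≡r₂η q₁ (q₂ ℕ.* v)) (cong (ℕ._* η q₁ (q₂ ℕ.* v)) r₂≡q₂)) ⟨
          + ((q₂ ℕ.* v) mod N)     ≈⟨ ≋-resp-modulus N≡ (mod≋ (q₂ ℕ.* v) N) ⟩
          + (q₂ ℕ.* v)             ≡⟨ pos-* q₂ v ⟩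
          + q₂ * + v               ∎)))
          where
          open ≋-Reasoning (+ q₂ * (+ m * + n₁))
          N≡ : + N ≡ + q₂ * (+ m * + n₁)
          N≡ = trans (+-*-≡ q₁ n₁ N≡q₁n₁) (trans (cong (_* + n₁) (+-*-≡ q₂ m q₁≡q₂m)) (*-assoc (+ q₂) (+ m) (+ n₁)))

      representative-cls : cls N (q₁ , q₂ ℕ.* v) ≡ [ q₁ , q₂ , u ]
      representative-cls = triple-cong r₁≡q₁ r₂≡q₂ (begin
        u′ q₁ (q₂ ℕ.* v) mod g q₁ (q₂ ℕ.* v)  ≡⟨ cong (u′ q₁ (q₂ ℕ.* v) mod_) (cong₂ (gT N) r₁≡q₁ r₂≡q₂) ⟩
        u′ q₁ (q₂ ℕ.* v) mod g′               ≡⟨ ≋⇒mod≡ g′ (≋-trans (≋-reflexive (pos-* (ξ q₁) _)) (≋-trans (*-cong ξ≋1 η≋v) (≋-reflexive (*-identityˡ (+ v))))) ⟩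
        v mod g′                              ≡⟨ v≡u ⟩
        u                                     ∎)
        where open ≡-Reasoning

  cls-resp-≋ : ∀ {x y x' y'} → + x' ≋ + x [ + N ] → + y' ≋ + y [ + N ] → cls N (x' , y') ≡ cls N (x , y)
  cls-resp-≋ {x} {y} {x'} {y'} x'≋x y'≋y = Triangular.cls-invariant {x} {y} {x'} {y'} {1ℤ} {0ℤ} {1ℤ} {1ℤ} {1ℤ} ≋-refl ≋-refl
    (≋-trans x'≋x (≋-reflexive (sym (*-identityʳ (+ x)))))
    (≋-trans y'≋y (≋-reflexive (y≡x*0+y*1 (+ x) (+ y))))
    ≋-refl

  reduce : ℕ → Fin N
  reduce x = fromℕ< (mod<divisor x (ℕ.>-nonZero⁻¹ N))

  cls-surjective : ∀ {t} → InO N t → ∃ λ p → cls N (lift p) ≡ t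
  cls-surjective {[ q₁ , q₂ , u ]} t∈𝒪 = (reduce q₁ , reduce (q₂ ℕ.* v)) ,
    trans (cls-resp-≋ (reduce≋ q₁) (reduce≋ (q₂ ℕ.* v))) (representative-cls v≡u v⊥m)
    where
    open Representative t∈𝒪
    v = proj₁ representative-exists
    v≡u = proj₁ (proj₂ representative-exists)
    v⊥m = proj₂ (proj₂ representative-exists)
    reduce≋ : ∀ x → + toℕ (reduce x) ≋ + x [ + N ]
    reduce≋ x = ≋-trans (≋-reflexive (cong +_ (toℕ-fromℕ< _))) (mod≋ x N)

module OrbitSize (N : ℕ) .{{_ : NonZero N}} where

  open import Data.Nat using (_<_; _≟_)
  open Congruence
  open Sums
  open Invariants N
  open Classification N
  open import Data.Integer using (ℤ; +_; _+_; _*_; 0ℤ; 1ℤ)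
  open import Data.Integer.Properties using (pos-*; *-comm; *-assoc; *-identityʳ)
  open import Data.Integer.Tactic.RingSolver using (solve-∀)
  import Data.Integer.DivMod as ℤ
  import Data.Nat.Properties as ℕ
  import Data.Nat.Divisibility as ℕ
  import Data.Nat.GCD as ℕ
  open import Algebra.Properties.CommutativeSemigroup ℕ.*-commutativeSemigroup using (x∙yz≈y∙xz)
  open import Data.Product using (_×_; _,_; proj₁; proj₂)
  open import Relation.Nullary using (Dec; yes; no)
  open import Relation.Binary.PropositionalEquality hiding ([_])
  open import Defs
  open import Data.List using (List; length; filter; cartesianProduct; allFin)
  open import Data.List.Membership.Propositional using (_∈_)
  open import Data.List.Membership.Propositional.Properties using (∈-filter⁺; ∈-filter⁻; ∈-cartesianProduct⁺; ∈-allFin)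
  open import Data.List.Relation.Unary.Unique.Propositional using (Unique)
  open import Data.List.Relation.Unary.Unique.Propositional.Properties using (filter⁺; cartesianProduct⁺; allFin⁺)

  _≟ᵗ_ : (s t : Triple) → Dec (s ≡ t)
  [ a , b , c ] ≟ᵗ [ a' , b' , c' ] with a ≟ a' | b ≟ b' | c ≟ c'
  ... | yes refl | yes refl | yes refl = yes refl
  ... | no a≢a'  | _        | _        = no (λ e → a≢a' (cong Triple.q₁ e))
  ... | yes _    | no b≢b'  | _        = no (λ e → b≢b' (cong Triple.q₂ e))
  ... | yes _    | yes _    | no c≢c'  = no (λ e → c≢c' (cong u e))

  fiber-size : Triple → ℕ
  fiber-size t = ∑< N (λ x → ∑< N (λ y → 𝟙 (cls N (x , y) ≟ᵗ t)))

  module FiberSize {q₁ q₂ u₀ : ℕ} (t∈𝒪 : InO N [ q₁ , q₂ , u₀ ]) where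

    private
      g′ = gT N q₁ q₂
      n₁ = N div q₁
      m  = q₁ div q₂

      g≡g′ : ∀ {x y} → r₁ x ≡ q₁ → r₂ x y ≡ q₂ → g x y ≡ g′
      g≡g′ = cong₂ (gT N)

    cls≡⇒u′≋ : ∀ {x y c} → c < g′ → cls N (x , y) ≡ [ q₁ , q₂ , c ] → + u′ x y ≋ + c [ + g′ ]
    cls≡⇒u′≋ {x} {y} {c} c<g′ same = mod≡⇒≋ g′ (begin
      u′ x y mod g′     ≡⟨ cong (u′ x y mod_) (g≡g′ (cong Triple.q₁ same) (cong Triple.q₂ same)) ⟨
      u′ x y mod g x y  ≡⟨ cong u same ⟩
      c                 ≡⟨ mod-small c<g′ ⟨
      c mod g′          ∎)
      where open ≡-Reasoning

    u′≋⇒cls≡ : ∀ {x y c} → c < g′ → r₁ x ≡ q₁ → r₂ x y ≡ q₂ → + u′ x y ≋ + c [ + g′ ] → cls N (x , y) ≡ [ q₁ , q₂ , c ]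
    u′≋⇒cls≡ {x} {y} {c} c<g′ r₁≡ r₂≡ u′≋c = triple-cong r₁≡ r₂≡ (begin
      u′ x y mod g x y  ≡⟨ cong (u′ x y mod_) (g≡g′ r₁≡ r₂≡) ⟩
      u′ x y mod g′     ≡⟨ ≋⇒mod≡ g′ u′≋c ⟩
      c mod g′          ≡⟨ mod-small c<g′ ⟩
      c                 ∎)
      where open ≡-Reasoning

    private
      g′∣N : g′ ℕ.∣ N
      g′∣N = ℕ.∣-trans (ℕ.gcd[m,n]∣m n₁ m) (ℕ.divides q₁ (n≡[n/d]*d (proj₁ (proj₂ t∈𝒪))))

    -- Multiplying x by a unit s ≡ u₀ w⁻¹ (mod g′) carries the fiber of w onto the fiber of u₀.
    module _ {w : ℕ} (w<g′ : w < g′) (w⊥g′ : ℕ.gcd w g′ ≡ 1) where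

      private
        w̄ = proj₁ (coprime⇒inverse (gcd≡1⇒coprime {w} {g′} w⊥g′))
        ww̄≋1 : + w * w̄ ≋ 1ℤ [ + g′ ]
        ww̄≋1 = proj₂ (coprime⇒inverse (gcd≡1⇒coprime {w} {g′} w⊥g′))
        u₀w̄⊥g′ : Coprime (+ u₀ * w̄) (+ g′)
        u₀w̄⊥g′ = coprime-* (gcd≡1⇒coprime {u₀} {g′} (proj₂ (proj₂ (proj₂ t∈𝒪))))
                            (inverse⇒coprime (≋-trans (≋-reflexive (*-comm w̄ (+ w))) ww̄≋1))
        unit = lift-unit g′ N g′∣N u₀w̄⊥g′
        s = proj₁ unit
        s̄ = proj₁ (coprime⇒inverse (proj₂ (proj₂ unit)))
        ss̄≋1 : + s * s̄ ≋ 1ℤ [ + N ]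
        ss̄≋1 = proj₂ (coprime⇒inverse (proj₂ (proj₂ unit)))
        s̃ = s̄ ℤ.%ℕ N
        ss̃≋1 : + s * + s̃ ≋ 1ℤ [ + N ]
        ss̃≋1 = ≋-trans (*-congˡ (+ s) (≋-sym (≋-residue s̄ N))) ss̄≋1

        sw≋u₀ : + s * + w ≋ + u₀ [ + g′ ]
        sw≋u₀ = begin
          + s * + w          ≈⟨ *-congʳ (+ w) (proj₁ (proj₂ unit)) ⟩
          + u₀ * w̄ * + w     ≡⟨ regroup (+ u₀) w̄ (+ w) ⟩
          + u₀ * (+ w * w̄)   ≈⟨ *-congˡ (+ u₀) ww̄≋1 ⟩
          + u₀ * 1ℤ          ≡⟨ *-identityʳ (+ u₀) ⟩
          + u₀               ∎
          where
          open ≋-Reasoning (+ g′)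
          regroup : ∀ u w̄ w → u * w̄ * w ≡ u * (w * w̄)
          regroup = solve-∀

        σ : ℕ → ℕ
        σ x = (x ℕ.* s) mod N

        τ : ℕ → ℕ
        τ x = (x ℕ.* s̃) mod N

        module Scaled (x y : ℕ) = Triangular {x} {y} {σ x} {y} {+ s} {0ℤ} {1ℤ} {s̄} {1ℤ} ss̄≋1 ≋-refl
          (≋-trans (mod≋ (x ℕ.* s) N) (≋-reflexive (pos-* x s)))
          (≋-reflexive (y≡x*0+y*1 (+ x) (+ y)))

        u′σ≋u′s : ∀ {x y} → r₁ x ≡ q₁ → r₂ x y ≡ q₂ → + u′ (σ x) y ≋ + u′ x y * + s [ + g′ ]
        u′σ≋u′s {x} {y} r₁≡ r₂≡ = ≋-trans
          (≋-resp-modulus (cong +_ (g≡g′ r₁≡ r₂≡)) (Scaled.u′-scaled x y))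
          (≋-reflexive (cong (+ u′ x y *_) (*-identityʳ (+ s))))

        σ-moves-fiber : ∀ x y → cls N (σ x , y) ≡ [ q₁ , q₂ , u₀ ] → cls N (x , y) ≡ [ q₁ , q₂ , w ]
        σ-moves-fiber x y same = u′≋⇒cls≡ w<g′ r₁≡ r₂≡ (*-cancelʳ-unit (begin
          + u′ x y * + s     ≈⟨ u′σ≋u′s r₁≡ r₂≡ ⟨
          + u′ (σ x) y       ≈⟨ cls≡⇒u′≋ (proj₁ (proj₂ (proj₂ t∈𝒪))) same ⟩
          + u₀               ≈⟨ sw≋u₀ ⟨
          + s * + w          ≡⟨ *-comm (+ s) (+ w) ⟩
          + w * + s          ∎) (≋-divisor g′∣N ss̄≋1))
          where
          open ≋-Reasoning (+ g′)
          r₁≡ : r₁ x ≡ q₁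
          r₁≡ = trans (sym (Scaled.r₁-invariant x y)) (cong Triple.q₁ same)
          r₂≡ : r₂ x y ≡ q₂
          r₂≡ = trans (sym (Scaled.r₂-invariant x y)) (cong Triple.q₂ same)

        σ-moves-fiber⁻ : ∀ x y → cls N (x , y) ≡ [ q₁ , q₂ , w ] → cls N (σ x , y) ≡ [ q₁ , q₂ , u₀ ]
        σ-moves-fiber⁻ x y same = u′≋⇒cls≡ (proj₁ (proj₂ (proj₂ t∈𝒪)))
          (trans (Scaled.r₁-invariant x y) (cong Triple.q₁ same)) (trans (Scaled.r₂-invariant x y) (cong Triple.q₂ same)) (begin
          + u′ (σ x) y     ≈⟨ u′σ≋u′s (cong Triple.q₁ same) (cong Triple.q₂ same) ⟩
          + u′ x y * + s   ≈⟨ *-congʳ (+ s) (cls≡⇒u′≋ w<g′ same) ⟩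
          + w * + s        ≡⟨ *-comm (+ w) (+ s) ⟩
          + s * + w        ≈⟨ sw≋u₀ ⟩
          + u₀             ∎)
          where open ≋-Reasoning (+ g′)

      fiber-size-unit-invariant : fiber-size [ q₁ , q₂ , w ] ≡ fiber-size [ q₁ , q₂ , u₀ ]
      fiber-size-unit-invariant = begin
        ∑< N (λ x → ∑< N (λ y → 𝟙 (cls N (x , y) ≟ᵗ [ q₁ , q₂ , w ])))     ≡⟨ ∑<-cong N (λ x _ → ∑<-cong N (λ y _ → moved x y)) ⟩
        ∑< N (λ x → ∑< N (λ y → 𝟙 (cls N (σ x , y) ≟ᵗ [ q₁ , q₂ , u₀ ])))  ≡⟨ ∑<-permute N σ τ σ<N σ<N τσ≡id στ≡id _ ⟩
        ∑< N (λ x → ∑< N (λ y → 𝟙 (cls N (x , y) ≟ᵗ [ q₁ , q₂ , u₀ ])))    ∎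
        where
        open ≡-Reasoning
        moved : ∀ x y → 𝟙 (cls N (x , y) ≟ᵗ [ q₁ , q₂ , w ]) ≡ 𝟙 (cls N (σ x , y) ≟ᵗ [ q₁ , q₂ , u₀ ])
        moved x y = 𝟙-cong (cls N (x , y) ≟ᵗ [ q₁ , q₂ , w ]) (cls N (σ x , y) ≟ᵗ [ q₁ , q₂ , u₀ ]) (σ-moves-fiber⁻ x y) (σ-moves-fiber x y)
        σ<N : ∀ {c} x → x < N → (x ℕ.* c) mod N < N
        σ<N x _ = mod<divisor _ (ℕ.>-nonZero⁻¹ N)
        τσ≡id : ∀ x → x < N → τ (σ x) ≡ x
        τσ≡id x = mod-inverse N ss̃≋1
        στ≡id : ∀ x → x < N → σ (τ x) ≡ x
        στ≡id x = mod-inverse N (≋-trans (≋-reflexive (*-comm (+ s̃) (+ s))) ss̃≋1)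

    private
      is-unit : ℕ → ℕ
      is-unit w = 𝟙 (ℕ.gcd w g′ ≟ 1)

      ∑-unit-fibers≡φ*fiber : ∑< g′ (λ w → is-unit w ℕ.* fiber-size [ q₁ , q₂ , w ]) ≡ φ g′ ℕ.* fiber-size [ q₁ , q₂ , u₀ ]
      ∑-unit-fibers≡φ*fiber = begin
        ∑< g′ (λ w → is-unit w ℕ.* fiber-size [ q₁ , q₂ , w ])   ≡⟨ ∑<-cong g′ (λ w w<g′ → same-size w<g′ (ℕ.gcd w g′ ≟ 1)) ⟩
        ∑< g′ (λ w → is-unit w ℕ.* fiber-size [ q₁ , q₂ , u₀ ])  ≡⟨ ∑<-*ʳ g′ _ is-unit ⟩
        ∑< g′ is-unit ℕ.* fiber-size [ q₁ , q₂ , u₀ ]             ≡⟨ cong (ℕ._* fiber-size [ q₁ , q₂ , u₀ ]) (φ≡∑<coprime g′) ⟨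
        φ g′ ℕ.* fiber-size [ q₁ , q₂ , u₀ ]                      ∎
        where
        open ≡-Reasoning
        same-size : ∀ {w} → w < g′ → (unit? : Dec (ℕ.gcd w g′ ≡ 1)) →
                    𝟙 unit? ℕ.* fiber-size [ q₁ , q₂ , w ] ≡ 𝟙 unit? ℕ.* fiber-size [ q₁ , q₂ , u₀ ]
        same-size w<g′ (yes w⊥g′) = cong (1 ℕ.*_) (fiber-size-unit-invariant w<g′ w⊥g′)
        same-size w<g′ (no _)     = refl

      -- each (x, y) with invariants q₁, q₂ lies in exactly one fiber, and its u is a unit
      units-at : ∀ x y → y < N → ∑< g′ (λ w → is-unit w ℕ.* 𝟙 (cls N (x , y) ≟ᵗ [ q₁ , q₂ , w ]))
                                 ≡ 𝟙 (r₁ x ≟ q₁) ℕ.* 𝟙 (ℕ.gcd y q₁ ≟ q₂)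
      units-at x y y<N = by-cases (r₁ x ≟ q₁) (ℕ.gcd y q₁ ≟ q₂)
        where
        not-in-fiber : (∀ {w} → cls N (x , y) ≢ [ q₁ , q₂ , w ]) → ∑< g′ (λ w → is-unit w ℕ.* 𝟙 (cls N (x , y) ≟ᵗ [ q₁ , q₂ , w ])) ≡ 0
        not-in-fiber ∉ = ∑<-zero g′ _ λ w _ →
          trans (cong (is-unit w ℕ.*_) (𝟙≡0 (cls N (x , y) ≟ᵗ [ q₁ , q₂ , w ]) ∉)) (ℕ.*-zeroʳ (is-unit w))
        by-cases : (r₁? : Dec (r₁ x ≡ q₁)) (r₂? : Dec (ℕ.gcd y q₁ ≡ q₂)) →
                   ∑< g′ (λ w → is-unit w ℕ.* 𝟙 (cls N (x , y) ≟ᵗ [ q₁ , q₂ , w ])) ≡ 𝟙 r₁? ℕ.* 𝟙 r₂?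
        by-cases (no r₁≢q₁) _ = not-in-fiber (λ e → r₁≢q₁ (cong Triple.q₁ e))
        by-cases (yes r₁≡q₁) (no r₂≢q₂) =
          not-in-fiber (λ e → r₂≢q₂ (trans (sym (cong₂ ℕ.gcd (mod-small y<N) r₁≡q₁)) (cong Triple.q₂ e)))
        by-cases (yes r₁≡q₁) (yes gcd≡q₂) = trans (∑<-cong g′ (λ w _ → term w)) (∑<-𝟙≡ g′ U U<g′)
          where
          r₂≡q₂ : r₂ x y ≡ q₂
          r₂≡q₂ = trans (cong₂ ℕ.gcd (mod-small y<N) r₁≡q₁) gcd≡q₂
          U = u′ x y mod g′
          U<g′ : U < g′
          U<g′ = subst (λ z → u′ x y mod z < z) (g≡g′ r₁≡q₁ r₂≡q₂) (proj₁ (proj₂ (proj₂ (cls∈𝒪 x y))))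
          U⊥g′ : ℕ.gcd U g′ ≡ 1
          U⊥g′ = subst (λ z → ℕ.gcd (u′ x y mod z) z ≡ 1) (g≡g′ r₁≡q₁ r₂≡q₂) (proj₂ (proj₂ (proj₂ (cls∈𝒪 x y))))
          cls≡ : cls N (x , y) ≡ [ q₁ , q₂ , U ]
          cls≡ = triple-cong r₁≡q₁ r₂≡q₂ (cong (u′ x y mod_) (g≡g′ r₁≡q₁ r₂≡q₂))
          term : ∀ w → is-unit w ℕ.* 𝟙 (cls N (x , y) ≟ᵗ [ q₁ , q₂ , w ]) ≡ 𝟙 (w ≟ U)
          term w = trans
            (cong (is-unit w ℕ.*_) (𝟙-cong (cls N (x , y) ≟ᵗ [ q₁ , q₂ , w ]) (w ≟ U) (λ e → cong u (trans (sym e) cls≡)) (λ { refl → cls≡ })))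
            (*𝟙≡𝟙 (is-unit w) (w ≟ U) (λ { refl → 𝟙≡1 (ℕ.gcd U g′ ≟ 1) U⊥g′ }))

      ∑-unit-fibers≡pairs : ∑< g′ (λ w → is-unit w ℕ.* fiber-size [ q₁ , q₂ , w ])
                            ≡ ∑< N (λ x → ∑< N (λ y → 𝟙 (r₁ x ≟ q₁) ℕ.* 𝟙 (ℕ.gcd y q₁ ≟ q₂)))
      ∑-unit-fibers≡pairs = begin
        ∑< g′ (λ w → is-unit w ℕ.* fiber-size [ q₁ , q₂ , w ])
          ≡⟨ ∑<-cong g′ (λ w _ → trans (sym (∑<-*ˡ N (is-unit w) _)) (∑<-cong N (λ x _ → sym (∑<-*ˡ N (is-unit w) _)))) ⟩
        ∑< g′ (λ w → ∑< N (λ x → ∑< N (λ y → is-unit w ℕ.* 𝟙 (cls N (x , y) ≟ᵗ [ q₁ , q₂ , w ]))))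
          ≡⟨ ∑<-comm g′ N _ ⟩
        ∑< N (λ x → ∑< g′ (λ w → ∑< N (λ y → is-unit w ℕ.* 𝟙 (cls N (x , y) ≟ᵗ [ q₁ , q₂ , w ]))))
          ≡⟨ ∑<-cong N (λ x _ → ∑<-comm g′ N _) ⟩
        ∑< N (λ x → ∑< N (λ y → ∑< g′ (λ w → is-unit w ℕ.* 𝟙 (cls N (x , y) ≟ᵗ [ q₁ , q₂ , w ]))))
          ≡⟨ ∑<-cong N (λ x _ → ∑<-cong N (λ y y<N → units-at x y y<N)) ⟩
        ∑< N (λ x → ∑< N (λ y → 𝟙 (r₁ x ≟ q₁) ℕ.* 𝟙 (ℕ.gcd y q₁ ≟ q₂)))
          ∎
        where open ≡-Reasoning

      pairs≡ : ∑< N (λ x → ∑< N (λ y → 𝟙 (r₁ x ≟ q₁) ℕ.* 𝟙 (ℕ.gcd y q₁ ≟ q₂))) ≡ φ n₁ ℕ.* (n₁ ℕ.* φ m)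
      pairs≡ = begin
        ∑< N (λ x → ∑< N (λ y → 𝟙 (r₁ x ≟ q₁) ℕ.* 𝟙 (ℕ.gcd y q₁ ≟ q₂)))   ≡⟨ ∑<-cong N (λ x _ → ∑<-*ˡ N (𝟙 (r₁ x ≟ q₁)) _) ⟩
        ∑< N (λ x → 𝟙 (r₁ x ≟ q₁) ℕ.* Y)                                   ≡⟨ ∑<-*ʳ N Y _ ⟩
        ∑< N (λ x → 𝟙 (r₁ x ≟ q₁)) ℕ.* Y                                   ≡⟨ cong₂ ℕ._*_ x-count y-count ⟩
        φ n₁ ℕ.* (n₁ ℕ.* φ m)                                              ∎
        where
        open ≡-Reasoning
        Y = ∑< N (λ y → 𝟙 (ℕ.gcd y q₁ ≟ q₂))
        q₁∣N = proj₁ (proj₂ t∈𝒪)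
        q₂∣q₁ = proj₁ t∈𝒪
        N≡n₁q₁ : N ≡ n₁ ℕ.* q₁
        N≡n₁q₁ = trans (n≡[n/d]*d q₁∣N) (ℕ.*-comm q₁ n₁)
        q₁≡mq₂ : q₁ ≡ m ℕ.* q₂
        q₁≡mq₂ = trans (n≡[n/d]*d q₂∣q₁) (ℕ.*-comm q₂ m)
        q₁≢0 : q₁ ≢ 0
        q₁≢0 refl = ℕ.≢-nonZero⁻¹ N (trans N≡n₁q₁ (ℕ.*-zeroʳ n₁))
        x-count : ∑< N (λ x → 𝟙 (r₁ x ≟ q₁)) ≡ φ n₁
        x-count = trans (∑<-cong N (λ x x<N → cong (λ z → 𝟙 (ℕ.gcd z N ≟ q₁)) (mod-small x<N))) (∑<-gcd≡ n₁ q₁ N≡n₁q₁ q₁≢0)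
        y-count : Y ≡ n₁ ℕ.* φ m
        y-count = trans (∑<-gcd-periodic n₁ q₁ q₂ N≡n₁q₁)
          (cong (n₁ ℕ.*_) (∑<-gcd≡ m q₂ q₁≡mq₂ (λ q₂≡0 → q₁≢0 (trans q₁≡mq₂ (trans (cong (m ℕ.*_) q₂≡0) (ℕ.*-zeroʳ m))))))

    fiber-size-formula : fiber-size [ q₁ , q₂ , u₀ ] ℕ.* φ g′ ≡ n₁ ℕ.* φ n₁ ℕ.* φ m
    fiber-size-formula = begin
      fiber-size [ q₁ , q₂ , u₀ ] ℕ.* φ g′    ≡⟨ ℕ.*-comm _ (φ g′) ⟩
      φ g′ ℕ.* fiber-size [ q₁ , q₂ , u₀ ]    ≡⟨ ∑-unit-fibers≡φ*fiber ⟨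
      ∑< g′ (λ w → is-unit w ℕ.* fiber-size [ q₁ , q₂ , w ]) ≡⟨ ∑-unit-fibers≡pairs ⟩
      _                                       ≡⟨ pairs≡ ⟩
      φ n₁ ℕ.* (n₁ ℕ.* φ m)                   ≡⟨ x∙yz≈y∙xz (φ n₁) n₁ (φ m) ⟩
      n₁ ℕ.* (φ n₁ ℕ.* φ m)                   ≡⟨ ℕ.*-assoc n₁ (φ n₁) (φ m) ⟨
      n₁ ℕ.* φ n₁ ℕ.* φ m                     ∎
      where open ≡-Reasoning

  orbit : Pt N → List (Pt N)
  orbit p = filter (λ p' → cls N (lift p') ≟ᵗ cls N (lift p)) (cartesianProduct (allFin N) (allFin N))

  orbit-unique : ∀ p → Unique (orbit p)
  orbit-unique p = filter⁺ _ (cartesianProduct⁺ (allFin⁺ N) (allFin⁺ N))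

  ∈-orbit⇔ : ∀ p p' → (p' ∈ orbit p → SameOrbit p p') × (SameOrbit p p' → p' ∈ orbit p)
  ∈-orbit⇔ p p'@(x' , y') =
    (λ p'∈ → same-cls⇒orbit {p} {p'} (sym (proj₂ (∈-filter⁻ _ {xs = cartesianProduct (allFin N) (allFin N)} p'∈)))) ,
    (λ o → ∈-filter⁺ _ (∈-cartesianProduct⁺ (∈-allFin x') (∈-allFin y')) (sym (cls-orbit-invariant {p} {p'} o)))

  length-orbit : ∀ p → length (orbit p) ≡ fiber-size (cls N (lift p))
  length-orbit p = count-cartesianProduct _ N (λ i → i) (allFin N) _
    (λ _ → count-tabulate _ N (λ j → j) _ (λ _ → refl))

open import Defs
open import Data.Nat using (ℕ; _*_; _≤_)
open import Data.Nat.GCD using (gcd)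
open import Data.Product using (_×_; _,_; Σ; ∃)
open import Data.List using (List; length)
open import Data.List.Membership.Propositional using (_∈_)
open import Data.List.Relation.Unary.Unique.Propositional using (Unique)
open import Data.Fin using (toℕ)
open import Relation.Binary.PropositionalEquality using (_≡_; refl; trans; cong₂)

mainTheorem10 : (N : ℕ) → 1 ≤ N →
    ((p : Pt N) → InO N (cls N (lift p)))
    × ((p p' : Pt N) → SameOrbit p p' → cls N (lift p) ≡ cls N (lift p'))
    × ((p p' : Pt N) → cls N (lift p) ≡ cls N (lift p') → SameOrbit p p')
    × ((t : Triple) → InO N t → ∃ λ (p : Pt N) → cls N (lift p) ≡ t)
    × ((t : Triple) → InO N t →
    (∃ λ (v : ℕ) → (v mod gT N (q₁ t) (q₂ t) ≡ u t) × gcd v (q₁ t div q₂ t) ≡ 1)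
    × ((v : ℕ) → v mod gT N (q₁ t) (q₂ t) ≡ u t → gcd v (q₁ t div q₂ t) ≡ 1 →
    cls N (q₁ t , q₂ t * v) ≡ t))
    × ((p : Pt N) → Σ (List (Pt N)) λ orb →
    Unique orb
    × ((p' : Pt N) → (p' ∈ orb → SameOrbit p p') × (SameOrbit p p' → p' ∈ orb))
    × length orb * φ (gT N (q₁ (cls N (lift p))) (q₂ (cls N (lift p))))
    ≡ (N div q₁ (cls N (lift p))) * φ (N div q₁ (cls N (lift p)))
    * φ (q₁ (cls N (lift p)) div q₂ (cls N (lift p))))
mainTheorem10 N 1≤N =
  (λ (x , y) → cls∈𝒪 (toℕ x) (toℕ y)) ,
  (λ p p' → cls-orbit-invariant {p} {p'}) ,
  (λ p p' → same-cls⇒orbit {p} {p'}) ,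
  (λ t → cls-surjective) ,
  (λ { [ q₁ , q₂ , u ] t∈𝒪 → Representative.representative-exists t∈𝒪 , λ v → Representative.representative-cls t∈𝒪 }) ,
  λ p → orbit p , orbit-unique p , ∈-orbit⇔ p ,
    trans (cong₂ _*_ (length-orbit p) refl) (FiberSize.fiber-size-formula (cls∈𝒪 _ _))
  where
  instance
    _ : ℕ.NonZero N
    _ = ℕ.>-nonZero 1≤N
  open Invariants N
  open Classification N
  open OrbitSize N
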